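{- Let $v\in\mathbb{Q}^n$ and $A\in\mathbb{Z}^{n\times n}$ with $\Delta=|\det A|>0$, let $\mathcal{G}=v+A\cdot[-1,1)^n$ and let $\mathcal{G}_I=(\mathbb{Z}^n\cap\mathcal{G},\oplus)$ be the integer tiling group induced by $\mathcal{G}$. Let $S=PAQ$ be the Smith Normal Form of $A$, where $P,Q\in\mathbb{Z}^{n\times n}$ are unimodular, and let $t_v=A^{ -1}v$. Then the vectors $b_1,\dots,b_n\in\mathcal{G}_I$ given by $$b_k=A\cdot\Bigl(t_v+\bigl\lceil t_v-\lfloor Q_{*k}/S_{kk}\rceil\bigr\rfloor\Bigr),\qquad k\in\{1,\dots,n\},$$ form a basis of $\mathcal{G}_I$.
   Context: For $y\in\mathbb{R}^n$, $\lfloor y\rceil$ denotes the unique $x\in[-1,1)^n$ with $y-x\in(2\mathbb{Z})^n$, and $\lceil y\rfloor$ denotes the unique $x\in[-1,1)^n$ with $y+x\in(2\mathbb{Z})^n$. With $t_v=A^{ -1}v$, every $y\in\mathbb{R}^n$ is written uniquely as $y=A(t_v+t_y)$; for $y,z\in\mathcal{G}$ define $y\oplus z=A\bigl(t_v+\lfloor t_v+t_y+t_z\rceil\bigr)$. The set $\mathcal{G}_I=\mathbb{Z}^n\cap\mathcal{G}$ with the operation $\oplus$ is a finite Abelian group (the integer tiling group induced by $\mathcal{G}$). $Q_{*k}$ is the $k$-th column of $Q$. A basis $b_1,\dots,b_n$ of a finite Abelian group means every element is uniquely a combination $i_1 b_1\oplus\dots\oplus i_n b_n$ with $0\le i_j<\operatorname{ord}(b_j)$.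 -}

module Defs where

open import Data.Nat using (ℕ; zero; suc)
import Data.Nat as ℕ
open import Data.Fin using (Fin; zero; suc; punchIn; _≟_)
open import Data.Integer as ℤ using (ℤ; +_; -[1+_]; ∣_∣)
open import Data.Rational as ℚ using (ℚ; 0ℚ; 1ℚ; floor; _/_)
open import Data.Product using (Σ; _×_; _,_)
open import Relation.Binary.PropositionalEquality using (_≡_; _≢_)
open import Data.Integer.Divisibility using () renaming (_∣_ to _∣ᶻ_)
open import Relation.Nullary using (¬_; yes; no)

Vecℚ : ℕ → Set
Vecℚ n = Fin n → ℚ

Mat : Set → ℕ → Set
Mat R n = Fin n → Fin n → R

sumℤ : ∀ {n} → (Fin n → ℤ) → ℤ
sumℤ {zero} f = + 0
sumℤ {suc n} f = f zero ℤ.+ sumℤ (λ i → f (suc i))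

sumℚ : ∀ {n} → (Fin n → ℚ) → ℚ
sumℚ {zero} f = 0ℚ
sumℚ {suc n} f = f zero ℚ.+ sumℚ (λ i → f (suc i))

fromℤ : ℤ → ℚ
fromℤ a = a / 1

-- a / b for integers, total (value 0 when b = 0; only used with b ≠ 0)
divℤ : ℤ → ℤ → ℚ
divℤ a (+ zero) = 0ℚ
divℤ a (+ suc m) = a / suc m
divℤ a -[1+ m ] = (ℤ.- a) / suc m

_*ᶻ_ : ∀ {n} → Mat ℤ n → Mat ℤ n → Mat ℤ n
(M *ᶻ N) i j = sumℤ (λ k → M i k ℤ.* N k j)

_*ᵠ_ : ∀ {n} → Mat ℚ n → Mat ℚ n → Mat ℚ n
(M *ᵠ N) i j = sumℚ (λ k → M i k ℚ.* N k j)

toℚMat : ∀ {n} → Mat ℤ n → Mat ℚ n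
toℚMat M i j = fromℤ (M i j)

_·_ : ∀ {n} → Mat ℤ n → Vecℚ n → Vecℚ n
(M · x) i = sumℚ (λ k → fromℤ (M i k) ℚ.* x k)

_·ᵠ_ : ∀ {n} → Mat ℚ n → Vecℚ n → Vecℚ n
(M ·ᵠ x) i = sumℚ (λ k → M i k ℚ.* x k)

idℚ : ∀ {n} → Mat ℚ n
idℚ i j with i ≟ j
... | yes _ = 1ℚ
... | no _ = 0ℚ

_+ᵛ_ : ∀ {n} → Vecℚ n → Vecℚ n → Vecℚ n
(x +ᵛ y) i = x i ℚ.+ y i

_-ᵛ_ : ∀ {n} → Vecℚ n → Vecℚ n → Vecℚ n
(x -ᵛ y) i = x i ℚ.- y i

minor : ∀ {n} → Mat ℤ (suc n) → Fin (suc n) → Mat ℤ n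
minor M j r c = M (suc r) (punchIn j c)

sign : ℕ → ℤ
sign zero = + 1
sign (suc zero) = -[1+ 0 ]
sign (suc (suc k)) = sign k

det : ∀ {n} → Mat ℤ n → ℤ
det {zero} M = + 1
det {suc n} M = sumℤ (λ j → sign (Data.Fin.toℕ j) ℤ.* (M zero j ℤ.* det (minor M j)))

Unimodular : ∀ {n} → Mat ℤ n → Set
Unimodular M = ∣ det M ∣ ≡ 1

IsSmithNormalForm : ∀ {n} → Mat ℤ n → Set
IsSmithNormalForm {n} S =
  (∀ i j → i ≢ j → S i j ≡ + 0)
  × (∀ i → + 0 ℤ.≤ S i i)
  × (∀ (k : ℕ) (p : k ℕ.< n) (q : suc k ℕ.< n) →
       S (Data.Fin.fromℕ< p) (Data.Fin.fromℕ< p) ∣ᶻ S (Data.Fin.fromℕ< q) (Data.Fin.fromℕ< q))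

-- ⌊ y ⌉ : the unique x ∈ [-1,1) with y - x ∈ 2ℤ   (x = y - 2⌊(y+1)/2⌋)
two : ℚ
two = + 2 / 1

half : ℚ
half = + 1 / 2

rd : ℚ → ℚ
rd y = y ℚ.- two ℚ.* fromℤ (floor ((y ℚ.+ 1ℚ) ℚ.* half))

-- ⌈ y ⌋ : the unique x ∈ [-1,1) with y + x ∈ 2ℤ   (x = -y - 2⌊(1-y)/2⌋)
ru : ℚ → ℚ
ru y = ℚ.- y ℚ.- two ℚ.* fromℤ (floor ((1ℚ ℚ.- y) ℚ.* half))

⌊_⌉ : ∀ {n} → Vecℚ n → Vecℚ n
⌊ y ⌉ i = rd (y i)

⌈_⌋ : ∀ {n} → Vecℚ n → Vecℚ n
⌈ y ⌋ i = ru (y i)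

-- The tiling set G = v + A·[-1,1)^n and its integer tiling group.
-- Ainv is the (rational) inverse of A, tv = A⁻¹ v, and
-- y = A (tv + ty) with ty = A⁻¹ y - tv.
module Tiling {n : ℕ} (v : Vecℚ n) (A : Mat ℤ n) (Ainv : Mat ℚ n) where

  tv : Vecℚ n
  tv = Ainv ·ᵠ v

  t : Vecℚ n → Vecℚ n
  t y = (Ainv ·ᵠ y) -ᵛ tv

  InG : Vecℚ n → Set
  InG y = ∀ i → (ℚ.- 1ℚ ℚ.≤ t y i) × (t y i ℚ.< 1ℚ)

  IsIntegral : Vecℚ n → Set
  IsIntegral y = ∀ i → Σ ℤ (λ a → y i ≡ fromℤ a)

  InGI : Vecℚ n → Set
  InGI y = IsIntegral y × InG y

  _⊕_ : Vecℚ n → Vecℚ n → Vecℚ n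
  y ⊕ z = A · (tv +ᵛ ⌊ (tv +ᵛ t y) +ᵛ t z ⌉)

  e : Vecℚ n
  e = A · (tv +ᵛ ⌈ tv ⌋)

  _≈_ : Vecℚ n → Vecℚ n → Set
  x ≈ y = ∀ i → x i ≡ y i

  _×ᵍ_ : ℕ → Vecℚ n → Vecℚ n
  zero ×ᵍ b = e
  suc m ×ᵍ b = b ⊕ (m ×ᵍ b)

  IsOrder : Vecℚ n → ℕ → Set
  IsOrder b m = (0 ℕ.< m) × ((m ×ᵍ b) ≈ e)
                × (∀ k → 0 ℕ.< k → k ℕ.< m → ¬ ((k ×ᵍ b) ≈ e))

  combo : ∀ {m} → (Fin m → ℕ) → (Fin m → Vecℚ n) → Vecℚ n
  combo {zero} i b = e
  combo {suc m} i b = (i zero ×ᵍ b zero) ⊕ combo (λ k → i (suc k)) (λ k → b (suc k))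

  IsBasis : ∀ {m} → (Fin m → Vecℚ n) → Set
  IsBasis {m} b =
    (∀ k → InGI (b k))
    × Σ (Fin m → ℕ) (λ o →
        (∀ k → IsOrder (b k) (o k))
        × (∀ y → InGI y →
             Σ (Fin m → ℕ) (λ i → (∀ k → i k ℕ.< o k) × (combo i b ≈ y)))
        × (∀ i j → (∀ k → i k ℕ.< o k) → (∀ k → j k ℕ.< o k) →
             combo i b ≈ combo j b → ∀ k → i k ≡ j k))

{-# OPTIONS --safe #-}
-- Work in the coordinates A⁻¹y. Call x and y congruent when A⁻¹x − A⁻¹y is an even
-- integer vector, i.e. x − y ∈ 2Aℤⁿ. Since ⌊_⌉ changes a coordinate by an even integer and
-- lands in [-1,1), every class has exactly one point reduce x in G = v + A·[-1,1)ⁿ, and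
-- ⊕, the neutral element and the multiples m·b are reduce applied to ordinary sums; so
-- G_I is the group ℤⁿ/2Aℤⁿ. The inverse U of P is integral (± the adjugate) and
-- A⁻¹U = QS⁻¹, so for the columns u_k of U the combinations Σ c_k u_k and Σ c′_k u_k
-- are congruent iff S⁻¹(c − c′) is even (Q is invertible over ℤ), i.e. iff 2S_kk divides
-- c_k − c′_k for every k. Finally b_k is congruent to u_k, because A⁻¹u_k = Q_{*k}/S_kk
-- and ⌊_⌉, ⌈_⌋ only add even integers; hence b_k has order 2S_kk and each element of
-- G_I is Σ i_k b_k for unique 0 ≤ i_k < 2S_kk.

module Submission where

open import Defs
open import Level using (0ℓ)
open import Algebra.Bundles using (CommutativeRing; Monoid)
open import Algebra.Core using (Op₁; Op₂)
open import Algebra.Structures using (IsCommutativeRing; IsMonoid)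
open import Data.Empty using (⊥-elim)
open import Data.Fin using (Fin; zero; suc; toℕ; punchIn; punchOut; _≟_)
open import Data.Fin.Properties using (punchInᵢ≢i; punchOut-cong; punchOut-punchIn; punchIn-punchOut; punchOut-injective)
open import Data.Integer as ℤ using (ℤ; +_; ∣_∣)
open import Data.Integer.Divisibility.Signed using (_∣_; divides; ∣⇒∣ᵤ)
import Data.Integer.DivMod as ℤD
import Data.Integer.Properties as ℤP
open import Data.Integer.Tactic.RingSolver using (solve-∀)
open import Data.Nat as ℕ using (ℕ; zero; suc)
open import Data.Nat.Coprimality using (Coprime)
import Data.Nat.Divisibility as ℕD
import Data.Nat.Properties as ℕP
open import Data.Product using (Σ; _×_; _,_; proj₁; proj₂)
open import Data.Rational as ℚ using (ℚ; mkℚ; 0ℚ; 1ℚ; floor; *≤*; *<*)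
import Data.Rational.Properties as ℚP
open import Data.Rational.Solver using (module +-*-Solver)
import Data.Rational.Unnormalised as ℚᵘ
import Data.Rational.Unnormalised.Properties as ℚᵘP
open import Function using (_∘_)
open import Relation.Binary.Bundles using (Setoid)
open import Relation.Binary.PropositionalEquality
  using (_≡_; _≢_; _≗_; refl; sym; trans; cong; cong₂; subst; subst₂; _→-setoid_; module ≡-Reasoning)
open import Relation.Nullary using (¬_; yes; no; contradiction)

open +-*-Solver using (solve; _:=_; con; _:+_; _:-_; _:*_; :-_)

-- The sum is a parameter rather than the library's, so that the instances ℤᴹ and ℚᴹ are
-- definitionally the sums, matrix products and matrix actions of Defs.
module Matrices {C : Set} {_+_ _*_ : Op₂ C} { -_ : Op₁ C} {0# 1# : C}
  (isCommutativeRing : IsCommutativeRing _≡_ _+_ _*_ -_ 0# 1#)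
  (∑ : ∀ {n} → (Fin n → C) → C)
  (∑-[] : ∀ f → ∑ {0} f ≡ 0#)
  (∑-∷ : ∀ {n} f → ∑ {suc n} f ≡ f zero + ∑ (f ∘ suc)) where

  commutativeRing : CommutativeRing 0ℓ 0ℓ
  commutativeRing = record { isCommutativeRing = isCommutativeRing }

  open CommutativeRing commutativeRing
    using (+-identityˡ; +-identityʳ; *-assoc; *-comm; *-identityˡ; *-identityʳ; zeroˡ; zeroʳ; distribˡ
          ; semiring; ring; *-commutativeSemigroup)
  open import Algebra.Properties.Ring ring using (-1*x≈-x)
  open import Algebra.Properties.CommutativeSemigroup *-commutativeSemigroup using (x∙yz≈y∙xz; x∙yz≈y∙zx)
  open import Algebra.Properties.Semiring.Sum semiring as Sum using (sum)
  open ≡-Reasoning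

  ∑≡sum : ∀ {n} (f : Fin n → C) → ∑ f ≡ sum f
  ∑≡sum {zero} f = ∑-[] f
  ∑≡sum {suc n} f = trans (∑-∷ f) (cong₂ _+_ refl (∑≡sum (f ∘ suc)))

  ∑-cong : ∀ {n} {f g : Fin n → C} → f ≗ g → ∑ f ≡ ∑ g
  ∑-cong {f = f} {g} f≗g = begin
    ∑ f   ≡⟨ ∑≡sum f ⟩
    sum f ≡⟨ Sum.sum-cong-≗ f≗g ⟩
    sum g ≡⟨ ∑≡sum g ⟨
    ∑ g   ∎

  ∑-distrib-+ : ∀ {n} (f g : Fin n → C) → ∑ (λ i → f i + g i) ≡ ∑ f + ∑ g
  ∑-distrib-+ f g = begin
    ∑ (λ i → f i + g i)    ≡⟨ ∑≡sum _ ⟩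
    sum (λ i → f i + g i)  ≡⟨ Sum.∑-distrib-+ f g ⟩
    sum f + sum g          ≡⟨ cong₂ _+_ (∑≡sum f) (∑≡sum g) ⟨
    ∑ f + ∑ g              ∎

  *-distribˡ-∑ : ∀ {n} x (f : Fin n → C) → x * ∑ f ≡ ∑ (λ i → x * f i)
  *-distribˡ-∑ x f = begin
    x * ∑ f              ≡⟨ cong (x *_) (∑≡sum f) ⟩
    x * sum f            ≡⟨ Sum.*-distribˡ-sum x f ⟩
    sum (λ i → x * f i)  ≡⟨ ∑≡sum _ ⟨
    ∑ (λ i → x * f i)    ∎

  ∑-comm : ∀ {m n} (f : Fin m → Fin n → C) → ∑ (λ i → ∑ (f i)) ≡ ∑ (λ j → ∑ (λ i → f i j))
  ∑-comm f = begin
    ∑ (λ i → ∑ (f i))                   ≡⟨ ∑∑≡sumsum f ⟩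
    sum (λ i → sum (f i))               ≡⟨ Sum.∑-comm f ⟩
    sum (λ j → sum (λ i → f i j))       ≡⟨ ∑∑≡sumsum (λ j i → f i j) ⟨
    ∑ (λ j → ∑ (λ i → f i j))           ∎
    where
    ∑∑≡sumsum : ∀ {m n} (g : Fin m → Fin n → C) → ∑ (λ i → ∑ (g i)) ≡ sum (λ i → sum (g i))
    ∑∑≡sumsum g = trans (∑≡sum _) (Sum.sum-cong-≗ (λ i → ∑≡sum (g i)))

  ∑-remove : ∀ {n} (i : Fin (suc n)) (f : Fin (suc n) → C) → ∑ f ≡ f i + ∑ (f ∘ punchIn i)
  ∑-remove i f = begin
    ∑ f                        ≡⟨ ∑≡sum f ⟩
    sum f                      ≡⟨ Sum.sum-remove f ⟩
    f i + sum (f ∘ punchIn i)  ≡⟨ cong₂ _+_ refl (∑≡sum _) ⟨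
    f i + ∑ (f ∘ punchIn i)    ∎

  ∑-zero : ∀ {n} {f : Fin n → C} → (∀ i → f i ≡ 0#) → ∑ f ≡ 0#
  ∑-zero {n} f≗0 = trans (∑-cong f≗0) (trans (∑≡sum _) (Sum.sum-replicate-zero n))

  ∑-removeZero : ∀ {n} (i : Fin (suc n)) (f : Fin (suc n) → C) → f i ≡ 0# → ∑ f ≡ ∑ (f ∘ punchIn i)
  ∑-removeZero i f fi≡0 = begin
    ∑ f                      ≡⟨ ∑-remove i f ⟩
    f i + ∑ (f ∘ punchIn i)  ≡⟨ cong₂ _+_ fi≡0 refl ⟩
    0# + ∑ (f ∘ punchIn i)   ≡⟨ +-identityˡ _ ⟩
    ∑ (f ∘ punchIn i)        ∎

  ∑-single : ∀ {n} (i : Fin n) {f : Fin n → C} → (∀ j → j ≢ i → f j ≡ 0#) → ∑ f ≡ f i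
  ∑-single {suc n} i {f} f≗0 = begin
    ∑ f                      ≡⟨ ∑-remove i f ⟩
    f i + ∑ (f ∘ punchIn i)  ≡⟨ cong₂ _+_ refl (∑-zero (λ j → f≗0 (punchIn i j) (punchInᵢ≢i i j))) ⟩
    f i + 0#                 ≡⟨ +-identityʳ (f i) ⟩
    f i                      ∎

  Matrix : ℕ → Set
  Matrix n = Fin n → Fin n → C

  infix 4 _≋_
  _≋_ : ∀ {n} → Matrix n → Matrix n → Set
  M ≋ N = ∀ i j → M i j ≡ N i j

  infixl 7 _⊗_
  _⊗_ : ∀ {n} → Matrix n → Matrix n → Matrix n
  (M ⊗ N) i j = ∑ (λ k → M i k * N k j)

  infixr 7 _⊛_
  _⊛_ : ∀ {n} → Matrix n → (Fin n → C) → Fin n → C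
  (M ⊛ x) i = ∑ (λ k → M i k * x k)

  1ᴹ : ∀ {n} → Matrix n
  1ᴹ i j with i ≟ j
  ... | yes _ = 1#
  ... | no _ = 0#

  1ᴹ-diag : ∀ {n} (i : Fin n) → 1ᴹ i i ≡ 1#
  1ᴹ-diag i with i ≟ i
  ... | yes _ = refl
  ... | no i≢i = ⊥-elim (i≢i refl)

  1ᴹ-off : ∀ {n} {i j : Fin n} → i ≢ j → 1ᴹ i j ≡ 0#
  1ᴹ-off {i = i} {j} i≢j with i ≟ j
  ... | yes i≡j = ⊥-elim (i≢j i≡j)
  ... | no _ = refl

  Diagonal : ∀ {n} → Matrix n → Set
  Diagonal D = ∀ i j → i ≢ j → D i j ≡ 0#

  ⊛-diagonal : ∀ {n} {D : Matrix n} → Diagonal D → ∀ x i → (D ⊛ x) i ≡ D i i * x i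
  ⊛-diagonal {D = D} D-diagonal x i = ∑-single i (λ k k≢i → trans (cong (_* x k) (D-diagonal i k (k≢i ∘ sym))) (zeroˡ (x k)))

  1ᴹ-diagonal : ∀ {n} → Diagonal (1ᴹ {n})
  1ᴹ-diagonal i j = 1ᴹ-off

  ⊛-congˡ : ∀ {n} {M N : Matrix n} → M ≋ N → ∀ x → M ⊛ x ≗ N ⊛ x
  ⊛-congˡ M≋N x i = ∑-cong (λ k → cong (_* x k) (M≋N i k))

  ⊛-congʳ : ∀ {n} (M : Matrix n) {x y : Fin n → C} → x ≗ y → M ⊛ x ≗ M ⊛ y
  ⊛-congʳ M x≗y i = ∑-cong (λ k → cong (M i k *_) (x≗y k))

  ⊛-assoc : ∀ {n} (M N : Matrix n) (x : Fin n → C) → (M ⊗ N) ⊛ x ≗ M ⊛ (N ⊛ x)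
  ⊛-assoc M N x i = begin
    ∑ (λ k → ∑ (λ l → M i l * N l k) * x k)   ≡⟨ ∑-cong (λ k → trans (*-comm _ (x k)) (*-distribˡ-∑ (x k) _)) ⟩
    ∑ (λ k → ∑ (λ l → x k * (M i l * N l k))) ≡⟨ ∑-comm _ ⟩
    ∑ (λ l → ∑ (λ k → x k * (M i l * N l k))) ≡⟨ ∑-cong (λ l → ∑-cong (λ k → x∙yz≈y∙zx (x k) (M i l) (N l k))) ⟩
    ∑ (λ l → ∑ (λ k → M i l * (N l k * x k))) ≡⟨ ∑-cong (λ l → *-distribˡ-∑ (M i l) _) ⟨
    ∑ (λ l → M i l * ∑ (λ k → N l k * x k))   ∎

  ⊗-assoc : ∀ {n} (M N K : Matrix n) → (M ⊗ N) ⊗ K ≋ M ⊗ (N ⊗ K)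
  ⊗-assoc M N K i j = ⊛-assoc M N (λ k → K k j) i

  ⊛-identityˡ : ∀ {n} (x : Fin n → C) → 1ᴹ ⊛ x ≗ x
  ⊛-identityˡ x i = begin
    (1ᴹ ⊛ x) i             ≡⟨ ⊛-diagonal 1ᴹ-diagonal x i ⟩
    1ᴹ i i * x i           ≡⟨ cong (_* x i) (1ᴹ-diag i) ⟩
    1# * x i               ≡⟨ *-identityˡ (x i) ⟩
    x i                    ∎

  ⊛-rightInverse : ∀ {n} (M N : Matrix n) → M ⊗ N ≋ 1ᴹ → ∀ x → M ⊛ (N ⊛ x) ≗ x
  ⊛-rightInverse M N MN≋1 x i = trans (sym (⊛-assoc M N x i)) (trans (⊛-congˡ MN≋1 x i) (⊛-identityˡ x i))

  ⊗-identityˡ : ∀ {n} (M : Matrix n) → 1ᴹ ⊗ M ≋ M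
  ⊗-identityˡ M i j = ⊛-identityˡ (λ k → M k j) i

  ⊗-identityʳ : ∀ {n} (M : Matrix n) → M ⊗ 1ᴹ ≋ M
  ⊗-identityʳ M i j = begin
    ∑ (λ k → M i k * 1ᴹ k j) ≡⟨ ∑-single j (λ k k≢j → trans (cong (M i k *_) (1ᴹ-off k≢j)) (zeroʳ (M i k))) ⟩
    M i j * 1ᴹ j j           ≡⟨ cong (M i j *_) (1ᴹ-diag j) ⟩
    M i j * 1#               ≡⟨ *-identityʳ (M i j) ⟩
    M i j                    ∎

  ⊗-isMonoid : ∀ {n} → IsMonoid (_≋_ {n}) _⊗_ 1ᴹ
  ⊗-isMonoid = record
    { isSemigroup = record
      { isMagma = record
        { isEquivalence = record
          { refl = λ i j → refl
          ; sym = λ M≋N i j → sym (M≋N i j)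
          ; trans = λ M≋N N≋K i j → trans (M≋N i j) (N≋K i j)
          }
        ; ∙-cong = λ M≋M′ N≋N′ i j → ∑-cong (λ k → cong₂ _*_ (M≋M′ i k) (N≋N′ k j))
        }
      ; assoc = ⊗-assoc
      }
    ; identity = ⊗-identityˡ , ⊗-identityʳ
    }

  ⊗-monoid : ℕ → Monoid 0ℓ 0ℓ
  ⊗-monoid n = record { isMonoid = ⊗-isMonoid {n} }

  ⊛-distrib-+ : ∀ {n} (M : Matrix n) (x y : Fin n → C) → M ⊛ (λ k → x k + y k) ≗ λ i → (M ⊛ x) i + (M ⊛ y) i
  ⊛-distrib-+ M x y i = trans (∑-cong (λ k → distribˡ (M i k) (x k) (y k))) (∑-distrib-+ _ _)

  ⊛-*ˡ : ∀ {n} (M : Matrix n) c (x : Fin n → C) → M ⊛ (λ k → c * x k) ≗ λ i → c * (M ⊛ x) i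
  ⊛-*ˡ M c x i = trans (∑-cong (λ k → x∙yz≈y∙xz (M i k) c (x k))) (sym (*-distribˡ-∑ c _))

  ⊛-distrib-difference : ∀ {n} (M : Matrix n) (x y : Fin n → C) → M ⊛ (λ k → x k + (- y k)) ≗ λ i → (M ⊛ x) i + (- (M ⊛ y) i)
  ⊛-distrib-difference M x y i = trans (⊛-distrib-+ M x (λ k → - y k) i) (cong₂ _+_ refl ⊛-neg)
    where
    ⊛-neg : (M ⊛ (λ k → - y k)) i ≡ - (M ⊛ y) i
    ⊛-neg = begin
      (M ⊛ (λ k → - y k)) i         ≡⟨ ⊛-congʳ M (λ k → -1*x≈-x (y k)) i ⟨
      (M ⊛ (λ k → (- 1#) * y k)) i  ≡⟨ ⊛-*ˡ M (- 1#) y i ⟩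
      (- 1#) * (M ⊛ y) i            ≡⟨ -1*x≈-x ((M ⊛ y) i) ⟩
      - (M ⊛ y) i                   ∎

  module DiagonalInverse {n} {D W : Matrix n} (D-diagonal : Diagonal D) (DW≋1 : D ⊗ W ≋ 1ᴹ) where

    private
      ⊗-row : ∀ i j → (D ⊗ W) i j ≡ D i i * W i j
      ⊗-row i j = ⊛-diagonal D-diagonal (λ k → W k j) i

    diagonal-inverse : ∀ i → D i i * W i i ≡ 1#
    diagonal-inverse i = trans (sym (⊗-row i i)) (trans (DW≋1 i i) (1ᴹ-diag i))

    inverse-diagonal : Diagonal W
    inverse-diagonal i j i≢j = begin
      W i j                    ≡⟨ *-identityˡ (W i j) ⟨
      1# * W i j               ≡⟨ cong (_* W i j) (trans (sym (diagonal-inverse i)) (*-comm (D i i) (W i i))) ⟩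
      (W i i * D i i) * W i j  ≡⟨ *-assoc (W i i) (D i i) (W i j) ⟩
      W i i * (D i i * W i j)  ≡⟨ cong (W i i *_) (trans (sym (⊗-row i j)) (trans (DW≋1 i j) (1ᴹ-off i≢j))) ⟩
      W i i * 0#               ≡⟨ zeroʳ (W i i) ⟩
      0#                       ∎

    inverse-leftInverse : W ⊗ D ≋ 1ᴹ
    inverse-leftInverse i j = begin
      (W ⊗ D) i j    ≡⟨ ⊛-diagonal inverse-diagonal (λ k → D k j) i ⟩
      W i i * D i j  ≡⟨ entry i j ⟩
      1ᴹ i j         ∎
      where
      entry : ∀ i j → W i i * D i j ≡ 1ᴹ i j
      entry i j with i ≟ j
      ... | yes refl = trans (*-comm (W i i) (D i i)) (diagonal-inverse i)
      ... | no i≢j = trans (cong (W i i *_) (D-diagonal i j i≢j)) (zeroʳ (W i i))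

module ℤᴹ = Matrices ℤP.+-*-isCommutativeRing sumℤ (λ _ → refl) (λ _ → refl)

module Determinant where

  open import Data.Integer using (_*_; -_)
  open import Algebra.Properties.CommutativeSemigroup ℤP.*-commutativeSemigroup using (x∙yz≈y∙xz)
  open ℤᴹ using (∑-cong; ∑-comm; ∑-removeZero; ∑-zero; *-distribˡ-∑; _⊗_; _≋_; 1ᴹ)
  open ≡-Reasoning

  sign-suc : ∀ k → sign (suc k) ≡ - sign k
  sign-suc zero = refl
  sign-suc (suc zero) = refl
  sign-suc (suc (suc k)) = sign-suc k

  sign-+ : ∀ a b → sign (a ℕ.+ b) ≡ sign a * sign b
  sign-+ zero b = sym (ℤP.*-identityˡ (sign b))
  sign-+ (suc a) b = begin
    sign (suc (a ℕ.+ b))  ≡⟨ sign-suc (a ℕ.+ b) ⟩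
    - sign (a ℕ.+ b)      ≡⟨ cong -_ (sign-+ a b) ⟩
    - (sign a * sign b)   ≡⟨ ℤP.neg-distribˡ-* (sign a) (sign b) ⟩
    - sign a * sign b     ≡⟨ cong (_* sign b) (sign-suc a) ⟨
    sign (suc a) * sign b ∎

  sign-suc-+-suc : ∀ a b → sign (suc a ℕ.+ suc b) ≡ sign (a ℕ.+ b)
  sign-suc-+-suc a b = cong (sign ∘ suc) (ℕP.+-suc a b)

  sign-punchOut : ∀ {n} {c d : Fin (suc n)} (c≢d : c ≢ d) (d≢c : d ≢ c) →
    sign (toℕ c ℕ.+ toℕ (punchOut c≢d)) ≡ - sign (toℕ d ℕ.+ toℕ (punchOut d≢c))
  sign-punchOut {c = zero} {zero} c≢d _ = ⊥-elim (c≢d refl)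
  sign-punchOut {suc n} {zero} {suc d} _ _ = begin
    sign (toℕ d)                      ≡⟨ ℤP.neg-involutive (sign (toℕ d)) ⟨
    - - sign (toℕ d)                  ≡⟨ cong -_ (sign-suc (toℕ d)) ⟨
    - sign (suc (toℕ d))              ≡⟨ cong (-_ ∘ sign) (ℕP.+-identityʳ (suc (toℕ d))) ⟨
    - sign (suc (toℕ d) ℕ.+ 0)        ∎
  sign-punchOut {suc n} {suc c} {zero} _ _ = begin
    sign (suc (toℕ c) ℕ.+ 0)          ≡⟨ cong sign (ℕP.+-identityʳ (suc (toℕ c))) ⟩
    sign (suc (toℕ c))                ≡⟨ sign-suc (toℕ c) ⟩
    - sign (toℕ c)                    ∎
  sign-punchOut {suc n} {suc c} {suc d} c≢d d≢c = begin
    sign (suc (toℕ c) ℕ.+ suc (toℕ (punchOut (c≢d ∘ cong suc))))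
      ≡⟨ sign-suc-+-suc (toℕ c) _ ⟩
    sign (toℕ c ℕ.+ toℕ (punchOut (c≢d ∘ cong suc)))
      ≡⟨ sign-punchOut (c≢d ∘ cong suc) (d≢c ∘ cong suc) ⟩
    - sign (toℕ d ℕ.+ toℕ (punchOut (d≢c ∘ cong suc)))
      ≡⟨ cong -_ (sign-suc-+-suc (toℕ d) _) ⟨
    - sign (suc (toℕ d) ℕ.+ suc (toℕ (punchOut (d≢c ∘ cong suc)))) ∎

  punchIn-punchOut-comm : ∀ {n} {c d : Fin (suc (suc n))} (c≢d : c ≢ d) (d≢c : d ≢ c) (b : Fin n) →
    punchIn c (punchIn (punchOut c≢d) b) ≡ punchIn d (punchIn (punchOut d≢c) b)
  punchIn-punchOut-comm {c = zero} {zero} c≢d _ _ = ⊥-elim (c≢d refl)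
  punchIn-punchOut-comm {c = zero} {suc d} _ _ _ = refl
  punchIn-punchOut-comm {c = suc c} {zero} _ _ _ = refl
  punchIn-punchOut-comm {c = suc c} {suc d} _ _ zero = refl
  punchIn-punchOut-comm {c = suc c} {suc d} c≢d d≢c (suc b) =
    cong suc (punchIn-punchOut-comm (c≢d ∘ cong suc) (d≢c ∘ cong suc) b)

  det-cong : ∀ {n} {M N : Mat ℤ n} → M ≋ N → det M ≡ det N
  det-cong {zero} M≋N = refl
  det-cong {suc n} M≋N =
    ∑-cong (λ j → cong₂ (λ x y → sign (toℕ j) * (x * y)) (M≋N zero j) (det-cong (λ a b → M≋N (suc a) (punchIn j b))))

  removeRowCol : ∀ {n} → Mat ℤ (suc n) → Fin (suc n) → Fin (suc n) → Mat ℤ n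
  removeRowCol M r c a b = M (punchIn r a) (punchIn c b)

  cofactor : ∀ {n} → Mat ℤ (suc n) → Fin (suc n) → Fin (suc n) → ℤ
  cofactor M r c = sign (toℕ r ℕ.+ toℕ c) * (M r c * det (removeRowCol M r c))

  cofactorExpansion : ∀ {n} → Mat ℤ (suc n) → Fin (suc n) → ℤ
  cofactorExpansion M r = sumℤ (cofactor M r)

  private
    *-*-distribˡ-∑ : ∀ {n} a b (f : Fin n → ℤ) → a * (b * sumℤ f) ≡ sumℤ (λ i → a * (b * f i))
    *-*-distribˡ-∑ a b f = trans (cong (a *_) (*-distribˡ-∑ b f)) (*-distribˡ-∑ a (λ i → b * f i))

  -- Expanding det M along row 0 and each minor along row r (by induction), or along row
  -- suc r and each minor along row 0, both give the sum of pairTerm c d over all pairs of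
  -- distinct columns c, d, where c is the column used in row 0 and d the one in row suc r.
  module RowExpansion {m} (M : Mat ℤ (suc (suc m))) (r : Fin (suc m)) where

    doubleMinor : ∀ {c d : Fin (suc (suc m))} → c ≢ d → Mat ℤ m
    doubleMinor {c} c≢d a b = M (suc (punchIn r a)) (punchIn c (punchIn (punchOut c≢d) b))

    pairTerm : Fin (suc (suc m)) → Fin (suc (suc m)) → ℤ
    pairTerm c d with c ≟ d
    ... | yes _ = + 0
    ... | no c≢d =
      sign (toℕ r) * sign (toℕ c ℕ.+ toℕ (punchOut c≢d)) * (M zero c * (M (suc r) d * det (doubleMinor c≢d)))

    pairTerm-diag : ∀ c → pairTerm c c ≡ + 0
    pairTerm-diag c with c ≟ c
    ... | yes _ = refl
    ... | no c≢c = ⊥-elim (c≢c refl)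

    firstRowTerm : Fin (suc (suc m)) → Fin (suc m) → ℤ
    firstRowTerm c d =
      sign (toℕ c) * (M zero c * cofactor (minor M c) r d)

    rowTerm : Fin (suc (suc m)) → Fin (suc m) → ℤ
    rowTerm d c =
      sign (toℕ (suc r) ℕ.+ toℕ d) * (M (suc r) d * cofactor (removeRowCol M (suc r) d) zero c)

    firstRowTerm≡pairTerm : ∀ c d → firstRowTerm c d ≡ pairTerm c (punchIn c d)
    firstRowTerm≡pairTerm c d with c ≟ punchIn c d
    ... | yes c≡c+d = ⊥-elim (punchInᵢ≢i c d (sym c≡c+d))
    ... | no c≢c+d = begin
      sign (toℕ c) * (a * (sign (toℕ r ℕ.+ toℕ d) * (b * D)))
        ≡⟨ cong (λ s → sign (toℕ c) * (a * (s * (b * D)))) (sign-+ (toℕ r) (toℕ d)) ⟩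
      sign (toℕ c) * (a * (sign (toℕ r) * sign (toℕ d) * (b * D)))
        ≡⟨ rearrange (sign (toℕ c)) a (sign (toℕ r)) (sign (toℕ d)) b D ⟩
      sign (toℕ r) * (sign (toℕ c) * sign (toℕ d)) * (a * (b * D))
        ≡⟨ cong (λ s → sign (toℕ r) * s * (a * (b * D))) (sign-+ (toℕ c) (toℕ d)) ⟨
      sign (toℕ r) * sign (toℕ c ℕ.+ toℕ d) * (a * (b * D))
        ≡⟨ cong₂ (λ d′ D′ → sign (toℕ r) * sign (toℕ c ℕ.+ toℕ d′) * (a * (b * D′))) d≡
                 (det-cong (λ i j → cong (λ k → M (suc (punchIn r i)) (punchIn c (punchIn k j))) d≡)) ⟨
      sign (toℕ r) * sign (toℕ c ℕ.+ toℕ (punchOut c≢c+d)) * (a * (b * det (doubleMinor c≢c+d))) ∎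
      where
      a = M zero c
      b = M (suc r) (punchIn c d)
      D = det (removeRowCol (minor M c) r d)
      d≡ : punchOut c≢c+d ≡ d
      d≡ = trans (punchOut-cong c refl) (punchOut-punchIn c)
      rearrange : ∀ x a y z b D → x * (a * (y * z * (b * D))) ≡ y * (x * z) * (a * (b * D))
      rearrange = solve-∀

    firstRow-distrib : ∀ c → sign (toℕ c) * (M zero c * cofactorExpansion (minor M c) r) ≡ sumℤ (firstRowTerm c)
    firstRow-distrib c = *-*-distribˡ-∑ (sign (toℕ c)) (M zero c) (cofactor (minor M c) r)

    row-distrib : ∀ d → cofactor M (suc r) d ≡ sumℤ (rowTerm d)
    row-distrib d = *-*-distribˡ-∑ (sign (toℕ (suc r) ℕ.+ toℕ d)) (M (suc r) d) (cofactor (removeRowCol M (suc r) d) zero)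

    rowTerm≡pairTerm : ∀ d c → rowTerm d c ≡ pairTerm (punchIn d c) d
    rowTerm≡pairTerm d c with punchIn d c ≟ d
    ... | yes d+c≡d = ⊥-elim (punchInᵢ≢i d c d+c≡d)
    ... | no d+c≢d = begin
      sign (suc (toℕ r ℕ.+ toℕ d)) * (b * (sign (toℕ c) * (a * D)))
        ≡⟨ cong (λ s → s * (b * (sign (toℕ c) * (a * D))))
                (trans (sign-suc (toℕ r ℕ.+ toℕ d)) (cong -_ (sign-+ (toℕ r) (toℕ d)))) ⟩
      - (sign (toℕ r) * sign (toℕ d)) * (b * (sign (toℕ c) * (a * D)))
        ≡⟨ rearrange (sign (toℕ r)) (sign (toℕ d)) b (sign (toℕ c)) a D ⟩
      sign (toℕ r) * - (sign (toℕ d) * sign (toℕ c)) * (a * (b * D))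
        ≡⟨ cong (λ s → sign (toℕ r) * - s * (a * (b * D))) (sign-+ (toℕ d) (toℕ c)) ⟨
      sign (toℕ r) * - sign (toℕ d ℕ.+ toℕ c) * (a * (b * D))
        ≡⟨ cong₂ (λ s D′ → sign (toℕ r) * s * (a * (b * D′))) sign≡
                 (det-cong (λ i j → cong (M (suc (punchIn r i))) (columns j))) ⟨
      sign (toℕ r) * sign (toℕ (punchIn d c) ℕ.+ toℕ (punchOut d+c≢d)) * (a * (b * det (doubleMinor d+c≢d))) ∎
      where
      a = M zero (punchIn d c)
      b = M (suc r) d
      D = det (minor (removeRowCol M (suc r) d) c)
      d≢d+c : d ≢ punchIn d c
      d≢d+c = punchInᵢ≢i d c ∘ sym
      c≡ : punchOut d≢d+c ≡ c
      c≡ = punchOut-punchIn d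
      sign≡ : sign (toℕ (punchIn d c) ℕ.+ toℕ (punchOut d+c≢d)) ≡ - sign (toℕ d ℕ.+ toℕ c)
      sign≡ = trans (sign-punchOut d+c≢d d≢d+c) (cong (λ k → - sign (toℕ d ℕ.+ toℕ k)) c≡)
      columns : ∀ j → punchIn (punchIn d c) (punchIn (punchOut d+c≢d) j) ≡ punchIn d (punchIn c j)
      columns j = trans (punchIn-punchOut-comm d+c≢d d≢d+c j) (cong (λ k → punchIn d (punchIn k j)) c≡)
      rearrange : ∀ x y b z a D → - (x * y) * (b * (z * (a * D))) ≡ x * - (y * z) * (a * (b * D))
      rearrange = solve-∀

  det-expansion : ∀ {n} (M : Mat ℤ (suc n)) r → cofactorExpansion M r ≡ det M
  det-expansion M zero = refl
  det-expansion {suc m} M (suc r) = begin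
    cofactorExpansion M (suc r)
      ≡⟨ ∑-cong row-distrib ⟩
    sumℤ (λ d → sumℤ (rowTerm d))
      ≡⟨ ∑-cong (λ d → ∑-cong (rowTerm≡pairTerm d)) ⟩
    sumℤ (λ d → sumℤ (λ c → pairTerm (punchIn d c) d))
      ≡⟨ ∑-cong (λ d → ∑-removeZero d (λ c → pairTerm c d) (pairTerm-diag d)) ⟨
    sumℤ (λ d → sumℤ (λ c → pairTerm c d))
      ≡⟨ ∑-comm pairTerm ⟨
    sumℤ (λ c → sumℤ (pairTerm c))
      ≡⟨ ∑-cong (λ c → ∑-removeZero c (pairTerm c) (pairTerm-diag c)) ⟩
    sumℤ (λ c → sumℤ (λ d → pairTerm c (punchIn c d)))
      ≡⟨ ∑-cong (λ c → ∑-cong (firstRowTerm≡pairTerm c)) ⟨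
    sumℤ (λ c → sumℤ (firstRowTerm c))
      ≡⟨ ∑-cong firstRow-distrib ⟨
    sumℤ (λ c → sign (toℕ c) * (M zero c * cofactorExpansion (minor M c) r))
      ≡⟨ ∑-cong (λ c → cong (λ x → sign (toℕ c) * (M zero c * x)) (det-expansion (minor M c) r)) ⟩
    det M ∎
    where open RowExpansion M r

  det-2×2 : (M : Mat ℤ 2) → det M ≡ M zero zero * M (suc zero) (suc zero) ℤ.- M zero (suc zero) * M (suc zero) zero
  det-2×2 M = expand (M zero zero) (M zero (suc zero)) (M (suc zero) zero) (M (suc zero) (suc zero))
    where
    expand : ∀ a b c d → + 1 * (a * (+ 1 * (d * + 1) ℤ.+ + 0)) ℤ.+ (ℤ.-[1+ 0 ] * (b * (+ 1 * (c * + 1) ℤ.+ + 0)) ℤ.+ + 0)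
                         ≡ a * d ℤ.- b * c
    expand = solve-∀

  avoid₂ : ∀ {n} (i j : Fin (3 ℕ.+ n)) → Σ (Fin (3 ℕ.+ n)) (λ r → r ≢ i × r ≢ j)
  avoid₂ zero          zero          = suc zero , (λ ()) , (λ ())
  avoid₂ zero          (suc zero)    = suc (suc zero) , (λ ()) , (λ ())
  avoid₂ zero          (suc (suc _)) = suc zero , (λ ()) , (λ ())
  avoid₂ (suc zero)    zero          = suc (suc zero) , (λ ()) , (λ ())
  avoid₂ (suc zero)    (suc zero)    = zero , (λ ()) , (λ ())
  avoid₂ (suc zero)    (suc (suc _)) = zero , (λ ()) , (λ ())
  avoid₂ (suc (suc _)) zero          = suc zero , (λ ()) , (λ ())
  avoid₂ (suc (suc _)) (suc _)       = zero , (λ ()) , (λ ())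

  cofactor-zero : ∀ {n} (M : Mat ℤ (suc n)) r c → det (removeRowCol M r c) ≡ + 0 → cofactor M r c ≡ + 0
  cofactor-zero M r c minor≡0 = begin
    sign (toℕ r ℕ.+ toℕ c) * (M r c * det (removeRowCol M r c))
      ≡⟨ cong (λ x → sign (toℕ r ℕ.+ toℕ c) * (M r c * x)) minor≡0 ⟩
    sign (toℕ r ℕ.+ toℕ c) * (M r c * + 0)
      ≡⟨ cong (sign (toℕ r ℕ.+ toℕ c) *_) (ℤP.*-zeroʳ (M r c)) ⟩
    sign (toℕ r ℕ.+ toℕ c) * + 0
      ≡⟨ ℤP.*-zeroʳ (sign (toℕ r ℕ.+ toℕ c)) ⟩
    + 0 ∎

  det-equalRows : ∀ {n} (M : Mat ℤ n) {i j : Fin n} → i ≢ j → (∀ c → M i c ≡ M j c) → det M ≡ + 0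
  det-equalRows {1} M {zero} {zero} i≢j _ = ⊥-elim (i≢j refl)
  det-equalRows {2} M {zero} {zero} i≢j _ = ⊥-elim (i≢j refl)
  det-equalRows {2} M {suc zero} {suc zero} i≢j _ = ⊥-elim (i≢j refl)
  det-equalRows {2} M {zero} {suc zero} _ rows = begin
    det M                      ≡⟨ det-2×2 M ⟩
    a * M (suc zero) (suc zero) ℤ.- b * M (suc zero) zero
                               ≡⟨ cong₂ (λ x y → a * x ℤ.- b * y) (rows (suc zero)) (rows zero) ⟨
    a * b ℤ.- b * a            ≡⟨ cancel a b ⟩
    + 0                        ∎
    where
    a = M zero zero
    b = M zero (suc zero)
    cancel : ∀ a b → a * b ℤ.- b * a ≡ + 0
    cancel = solve-∀
  det-equalRows {2} M {suc zero} {zero} i≢j rows = det-equalRows M (i≢j ∘ sym) (sym ∘ rows)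
  det-equalRows {suc (suc (suc n))} M {i} {j} i≢j rows = begin
    det M                    ≡⟨ det-expansion M r ⟨
    cofactorExpansion M r    ≡⟨ ∑-zero (λ c → cofactor-zero M r c (det-equalRows (removeRowCol M r c) minor-distinct (minor-rows c))) ⟩
    + 0                      ∎
    where
    r = proj₁ (avoid₂ i j)
    r≢i = proj₁ (proj₂ (avoid₂ i j))
    r≢j = proj₂ (proj₂ (avoid₂ i j))
    minor-distinct : punchOut r≢i ≢ punchOut r≢j
    minor-distinct = i≢j ∘ punchOut-injective r≢i r≢j
    minor-rows : ∀ c b → removeRowCol M r c (punchOut r≢i) b ≡ removeRowCol M r c (punchOut r≢j) b
    minor-rows c b = begin
      M (punchIn r (punchOut r≢i)) (punchIn c b) ≡⟨ cong (λ k → M k (punchIn c b)) (punchIn-punchOut r≢i) ⟩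
      M i (punchIn c b)                          ≡⟨ rows (punchIn c b) ⟩
      M j (punchIn c b)                          ≡⟨ cong (λ k → M k (punchIn c b)) (punchIn-punchOut r≢j) ⟨
      M (punchIn r (punchOut r≢j)) (punchIn c b) ∎

  adjugate : ∀ {n} → Mat ℤ (suc n) → Mat ℤ (suc n)
  adjugate M c r = sign (toℕ r ℕ.+ toℕ c) * det (removeRowCol M r c)

  replaceRow : ∀ {n} → Mat ℤ n → Fin n → Fin n → Mat ℤ n
  replaceRow M i j a c with a ≟ j
  ... | yes _ = M i c
  ... | no _ = M a c

  replaceRow-replaced : ∀ {n} (M : Mat ℤ n) i j c → replaceRow M i j j c ≡ M i c
  replaceRow-replaced M i j c with j ≟ j
  ... | yes _ = refl
  ... | no j≢j = ⊥-elim (j≢j refl)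

  replaceRow-other : ∀ {n} (M : Mat ℤ n) i j {a} c → a ≢ j → replaceRow M i j a c ≡ M a c
  replaceRow-other M i j {a} c a≢j with a ≟ j
  ... | yes a≡j = ⊥-elim (a≢j a≡j)
  ... | no _ = refl

  replaceRow-self : ∀ {n} (M : Mat ℤ n) i → replaceRow M i i ≋ M
  replaceRow-self M i a c with a ≟ i
  ... | yes refl = refl
  ... | no _ = refl

  det-replaceRow : ∀ {n} (M : Mat ℤ n) i j → det (replaceRow M i j) ≡ det M * 1ᴹ i j
  det-replaceRow M i j with i ≟ j
  ... | yes refl = begin
    det (replaceRow M i i) ≡⟨ det-cong (replaceRow-self M i) ⟩
    det M                  ≡⟨ ℤP.*-identityʳ (det M) ⟨
    det M * + 1            ∎
  ... | no i≢j = begin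
    det (replaceRow M i j) ≡⟨ det-equalRows (replaceRow M i j) i≢j equal ⟩
    + 0                    ≡⟨ ℤP.*-zeroʳ (det M) ⟨
    det M * + 0            ∎
    where
    equal : ∀ c → replaceRow M i j i c ≡ replaceRow M i j j c
    equal c = trans (replaceRow-other M i j c i≢j) (sym (replaceRow-replaced M i j c))

  ⊗-adjugate : ∀ {n} (M : Mat ℤ (suc n)) → M ⊗ adjugate M ≋ λ i j → det M * 1ᴹ i j
  ⊗-adjugate M i j = begin
    sumℤ (λ k → M i k * (sign (toℕ j ℕ.+ toℕ k) * det (removeRowCol M j k)))
      ≡⟨ ∑-cong (λ k → x∙yz≈y∙xz (M i k) (sign (toℕ j ℕ.+ toℕ k)) (det (removeRowCol M j k))) ⟩
    sumℤ (λ k → sign (toℕ j ℕ.+ toℕ k) * (M i k * det (removeRowCol M j k)))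
      ≡⟨ ∑-cong (λ k → cong₂ (λ x D → sign (toℕ j ℕ.+ toℕ k) * (x * D))
                             (replaceRow-replaced M i j k) (det-cong (unchanged k))) ⟨
    cofactorExpansion (replaceRow M i j) j
      ≡⟨ det-expansion (replaceRow M i j) j ⟩
    det (replaceRow M i j)
      ≡⟨ det-replaceRow M i j ⟩
    det M * 1ᴹ i j ∎
    where
    unchanged : ∀ k → removeRowCol (replaceRow M i j) j k ≋ removeRowCol M j k
    unchanged k a b = replaceRow-other M i j (punchIn k b) (punchInᵢ≢i j a)

  unimodular⇒rightInverse : ∀ {n} {M : Mat ℤ n} → Unimodular M → Σ (Mat ℤ n) (λ U → M ⊗ U ≋ 1ᴹ)
  unimodular⇒rightInverse {zero} {M} _ = M , λ ()
  unimodular⇒rightInverse {suc n} {M} ∣detM∣≡1 = (λ c r → det M * adjugate M c r) , λ i j → begin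
    sumℤ (λ k → M i k * (det M * adjugate M k j))  ≡⟨ ∑-cong (λ k → x∙yz≈y∙xz (M i k) (det M) (adjugate M k j)) ⟩
    sumℤ (λ k → det M * (M i k * adjugate M k j))  ≡⟨ *-distribˡ-∑ (det M) (λ k → M i k * adjugate M k j) ⟨
    det M * (M ⊗ adjugate M) i j                   ≡⟨ cong (det M *_) (⊗-adjugate M i j) ⟩
    det M * (det M * 1ᴹ i j)                       ≡⟨ ℤP.*-assoc (det M) (det M) (1ᴹ i j) ⟨
    det M * det M * 1ᴹ i j                         ≡⟨ cong (_* 1ᴹ i j) (square≡1 (det M) ∣detM∣≡1) ⟩
    + 1 * 1ᴹ i j                                   ≡⟨ ℤP.*-identityˡ (1ᴹ i j) ⟩
    1ᴹ i j                                         ∎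
    where
    square≡1 : ∀ d → ∣ d ∣ ≡ 1 → d * d ≡ + 1
    square≡1 (+ 1) _ = refl
    square≡1 ℤ.-[1+ 0 ] _ = refl

open Determinant using (unimodular⇒rightInverse)

1-coprime : ∀ n → Coprime n 1
1-coprime n (_ , d∣1) = ℕD.∣1⇒≡1 d∣1

fromℤ≡mkℚ : ∀ a → fromℤ a ≡ mkℚ a 0 (1-coprime ∣ a ∣)
fromℤ≡mkℚ (+ n) = ℚP.normalize-coprime (1-coprime n)
fromℤ≡mkℚ ℤ.-[1+ n ] = cong ℚ.-_ (ℚP.normalize-coprime (1-coprime (suc n)))

fromℤ-homo-+ : ∀ a b → fromℤ (a ℤ.+ b) ≡ fromℤ a ℚ.+ fromℤ b
fromℤ-homo-+ a b = begin
  fromℤ (a ℤ.+ b)                    ≡⟨ cong fromℤ (cong₂ ℤ._+_ (ℤP.*-identityʳ a) (ℤP.*-identityʳ b)) ⟨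
  fromℤ (a ℤ.* + 1 ℤ.+ b ℤ.* + 1)    ≡⟨ cong₂ ℚ._+_ (fromℤ≡mkℚ a) (fromℤ≡mkℚ b) ⟨
  fromℤ a ℚ.+ fromℤ b                ∎
  where open ≡-Reasoning

fromℤ-homo-* : ∀ a b → fromℤ (a ℤ.* b) ≡ fromℤ a ℚ.* fromℤ b
fromℤ-homo-* a b = sym (cong₂ ℚ._*_ (fromℤ≡mkℚ a) (fromℤ≡mkℚ b))

fromℤ-homo-neg : ∀ a → fromℤ (ℤ.- a) ≡ ℚ.- fromℤ a
fromℤ-homo-neg a = trans (fromℤ≡mkℚ (ℤ.- a)) (trans (mkℚ-neg a) (cong ℚ.-_ (sym (fromℤ≡mkℚ a))))
  where
  mkℚ-neg : ∀ a → mkℚ (ℤ.- a) 0 (1-coprime ∣ ℤ.- a ∣) ≡ ℚ.- mkℚ a 0 (1-coprime ∣ a ∣)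
  mkℚ-neg (+ zero) = refl
  mkℚ-neg (+ suc n) = refl
  mkℚ-neg ℤ.-[1+ n ] = refl

fromℤ-homo-∑ : ∀ {n} (f : Fin n → ℤ) → fromℤ (sumℤ f) ≡ sumℚ (fromℤ ∘ f)
fromℤ-homo-∑ {zero} f = refl
fromℤ-homo-∑ {suc n} f = trans (fromℤ-homo-+ (f zero) _) (cong (fromℤ (f zero) ℚ.+_) (fromℤ-homo-∑ (f ∘ suc)))

fromℤ-injective : ∀ {a b} → fromℤ a ≡ fromℤ b → a ≡ b
fromℤ-injective {a} {b} eq = cong ℚ.↥_ (trans (sym (fromℤ≡mkℚ a)) (trans eq (fromℤ≡mkℚ b)))

fromℤ-mono-≤ : ∀ {a b} → a ℤ.≤ b → fromℤ a ℚ.≤ fromℤ b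
fromℤ-mono-≤ {a} {b} a≤b rewrite fromℤ≡mkℚ a | fromℤ≡mkℚ b =
  *≤* (subst₂ ℤ._≤_ (sym (ℤP.*-identityʳ a)) (sym (ℤP.*-identityʳ b)) a≤b)

fromℤ-*-/ : ∀ a m → fromℤ (+ suc m) ℚ.* (a ℚ./ suc m) ≡ fromℤ a
fromℤ-*-/ a m rewrite fromℤ≡mkℚ (+ suc m) | fromℤ≡mkℚ a = ℚP.toℚᵘ-injective (begin
  ℚ.toℚᵘ (mkℚ (+ suc m) 0 _ ℚ.* (a ℚ./ suc m))      ≈⟨ ℚP.toℚᵘ-homo-* (mkℚ (+ suc m) 0 _) (a ℚ./ suc m) ⟩
  ℚᵘ.mkℚᵘ (+ suc m) 0 ℚᵘ.* ℚ.toℚᵘ (a ℚ./ suc m)    ≈⟨ ℚᵘP.*-congˡ {ℚᵘ.mkℚᵘ (+ suc m) 0} (ℚP.toℚᵘ-fromℚᵘ (ℚᵘ.mkℚᵘ a m)) ⟩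
  ℚᵘ.mkℚᵘ (+ suc m) 0 ℚᵘ.* ℚᵘ.mkℚᵘ a m             ≈⟨ ℚᵘ.*≡* cross ⟩
  ℚᵘ.mkℚᵘ a 0                                       ∎)
  where
  open ℚᵘP.≃-Reasoning
  cross : (+ suc m ℤ.* a) ℤ.* + 1 ≡ a ℤ.* (+ suc (m ℕ.+ 0))
  cross = trans (ℤP.*-identityʳ _) (trans (ℤP.*-comm (+ suc m) a) (cong (λ k → a ℤ.* + suc k) (sym (ℕP.+-identityʳ m))))

∣-bounded⇒≡ : ∀ {N x y} → x ℕ.< N → y ℕ.< N → + N ∣ + x ℤ.- + y → x ≡ y
∣-bounded⇒≡ {N} {x} {y} x<N y<N N∣x-y =
  ℤP.+-injective (ℤP.i-j≡0⇒i≡j (+ x) (+ y) (ℤP.∣i∣≡0⇒i≡0 (small-multiple (∣⇒∣ᵤ N∣x-y) ∣x-y∣<N)))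
  where
  ∣x-y∣<N : ∣ + x ℤ.- + y ∣ ℕ.< N
  ∣x-y∣<N = subst (ℕ._< N) (cong ∣_∣ (sym (ℤP.m-n≡m⊖n x y))) (ℕP.≤-<-trans (ℤP.∣m⊝n∣≤m⊔n x y) (ℕP.⊔-lub x<N y<N))
  small-multiple : ∀ {d} → N ℕD.∣ d → d ℕ.< N → d ≡ 0
  small-multiple {zero} _ _ = refl
  small-multiple {suc d} N∣d d<N = contradiction N∣d (ℕD.>⇒∤ d<N)

floor-≤ : ∀ q → fromℤ (floor q) ℚ.≤ q
floor-≤ q@(mkℚ n d _) rewrite fromℤ≡mkℚ (floor q) =
  *≤* (subst (floor q ℤ.* + suc d ℤ.≤_) (sym (ℤP.*-identityʳ n)) (ℤD.[n/d]*d≤n n (+ suc d)))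

<-floor+1 : ∀ q → q ℚ.< fromℤ (floor q ℤ.+ + 1)
<-floor+1 q@(mkℚ n d _) rewrite fromℤ≡mkℚ (floor q ℤ.+ + 1) =
  *<* (subst₂ ℤ._<_ (sym (ℤP.*-identityʳ n)) (cong (ℤ._* + suc d) floor+1) (ℤD.n<s[n/ℕd]*d n (suc d)))
  where
  floor+1 : ℤ.suc (n ℤD./ℕ suc d) ≡ floor q ℤ.+ + 1
  floor+1 = trans (ℤP.+-comm (+ 1) (n ℤD./ℕ suc d)) (cong (ℤ._+ + 1) (sym (ℤD.div-pos-is-/ℕ n (suc d))))

floor-unique : ∀ q m → fromℤ m ℚ.≤ q → q ℚ.< fromℤ (m ℤ.+ + 1) → floor q ≡ m
floor-unique q m m≤q q<m+1 = ℤP.≤-antisym (ℤP.≮⇒≥ (gap (floor-≤ q) q<m+1)) (ℤP.≮⇒≥ (gap m≤q (<-floor+1 q)))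
  where
  gap : ∀ {x y} → fromℤ x ℚ.≤ q → q ℚ.< fromℤ (y ℤ.+ + 1) → ¬ (y ℤ.< x)
  gap {x} {y} x≤q q<y+1 y<x = ℚP.<-irrefl refl (ℚP.<-≤-trans q<y+1 (ℚP.≤-trans (fromℤ-mono-≤ y+1≤x) x≤q))
    where
    y+1≤x : y ℤ.+ + 1 ℤ.≤ x
    y+1≤x = subst (ℤ._≤ x) (ℤP.+-comm (+ 1) y) (ℤP.i<j⇒suc[i]≤j y<x)

Even : ℚ → Set
Even x = Σ ℤ λ k → x ≡ two ℚ.* fromℤ k

Integral : ℚ → Set
Integral x = Σ ℤ λ a → x ≡ fromℤ a

Centred : ℚ → Set
Centred x = (ℚ.- 1ℚ ℚ.≤ x) × (x ℚ.< 1ℚ)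

Even-0 : Even 0ℚ
Even-0 = + 0 , refl

Even-+ : ∀ {x y} → Even x → Even y → Even (x ℚ.+ y)
Even-+ {x} {y} (k , x≡2k) (l , y≡2l) = k ℤ.+ l , (begin
  x ℚ.+ y                                ≡⟨ cong₂ ℚ._+_ x≡2k y≡2l ⟩
  two ℚ.* fromℤ k ℚ.+ two ℚ.* fromℤ l    ≡⟨ ℚP.*-distribˡ-+ two (fromℤ k) (fromℤ l) ⟨
  two ℚ.* (fromℤ k ℚ.+ fromℤ l)          ≡⟨ cong (two ℚ.*_) (fromℤ-homo-+ k l) ⟨
  two ℚ.* fromℤ (k ℤ.+ l)                ∎)
  where open ≡-Reasoning

Even-scale : ∀ c {x} → Even x → Even (fromℤ c ℚ.* x)
Even-scale c {x} (k , x≡2k) = c ℤ.* k , (begin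
  fromℤ c ℚ.* x                          ≡⟨ cong (fromℤ c ℚ.*_) x≡2k ⟩
  fromℤ c ℚ.* (two ℚ.* fromℤ k)          ≡⟨ solve 3 (λ c t k → c :* (t :* k) := t :* (c :* k)) refl (fromℤ c) two (fromℤ k) ⟩
  two ℚ.* (fromℤ c ℚ.* fromℤ k)          ≡⟨ cong (two ℚ.*_) (fromℤ-homo-* c k) ⟨
  two ℚ.* fromℤ (c ℤ.* k)                ∎)
  where open ≡-Reasoning

Even-neg : ∀ {x} → Even x → Even (ℚ.- x)
Even-neg {x} (k , x≡2k) = ℤ.- k , (begin
  ℚ.- x                        ≡⟨ cong ℚ.-_ x≡2k ⟩
  ℚ.- (two ℚ.* fromℤ k)        ≡⟨ solve 1 (λ K → :- (con two :* K) := con two :* (:- K)) refl (fromℤ k) ⟩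
  two ℚ.* ℚ.- fromℤ k          ≡⟨ cong (two ℚ.*_) (fromℤ-homo-neg k) ⟨
  two ℚ.* fromℤ (ℤ.- k)        ∎)
  where open ≡-Reasoning

Even-difference : ∀ {x y} → Even x → Even y → Even (x ℚ.- y)
Even-difference even-x even-y = Even-+ even-x (Even-neg even-y)

Even-∑ : ∀ {n} (f : Fin n → ℚ) → (∀ i → Even (f i)) → Even (sumℚ f)
Even-∑ {zero} f _ = Even-0
Even-∑ {suc n} f even = Even-+ (even zero) (Even-∑ (f ∘ suc) (even ∘ suc))

Even-⊛ : ∀ {n} (M : Mat ℤ n) {x : Vecℚ n} → (∀ k → Even (x k)) → ∀ i → Even ((toℚMat M ·ᵠ x) i)
Even-⊛ M even i = Even-∑ _ (λ k → Even-scale (M i k) (even k))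

Even⇒Integral : ∀ {x} → Even x → Integral x
Even⇒Integral (k , x≡2k) = + 2 ℤ.* k , trans x≡2k (sym (fromℤ-homo-* (+ 2) k))

Integral-+ : ∀ {x y} → Integral x → Integral y → Integral (x ℚ.+ y)
Integral-+ (a , x≡a) (b , y≡b) = a ℤ.+ b , trans (cong₂ ℚ._+_ x≡a y≡b) (sym (fromℤ-homo-+ a b))

Integral-∑ : ∀ {n} (f : Fin n → ℚ) → (∀ i → Integral (f i)) → Integral (sumℚ f)
Integral-∑ {zero} f _ = + 0 , refl
Integral-∑ {suc n} f int = Integral-+ (int zero) (Integral-∑ (f ∘ suc) (int ∘ suc))

rd-centred : ∀ y → Centred (rd y)
rd-centred y = subst (ℚ.- 1ℚ ℚ.≤_) (sym rd≡) lower , subst (ℚ._< 1ℚ) (sym rd≡) upper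
  where
  u = (y ℚ.+ 1ℚ) ℚ.* half
  F = fromℤ (floor u)
  w = u ℚ.- F
  rd≡ : rd y ≡ w ℚ.+ w ℚ.- 1ℚ
  rd≡ = solve 2 (λ y F → y :- con two :* F := ((y :+ con 1ℚ) :* con half :- F) :+ ((y :+ con 1ℚ) :* con half :- F) :- con 1ℚ) refl y F
  0≤w : 0ℚ ℚ.≤ w
  0≤w = subst (ℚ._≤ w) (ℚP.+-inverseʳ F) (ℚP.+-monoˡ-≤ (ℚ.- F) (floor-≤ u))
  w<1 : w ℚ.< 1ℚ
  w<1 = subst (w ℚ.<_) (solve 1 (λ F → (F :+ con 1ℚ) :- F := con 1ℚ) refl F)
          (ℚP.+-monoˡ-< (ℚ.- F) (subst (u ℚ.<_) (fromℤ-homo-+ (floor u) (+ 1)) (<-floor+1 u)))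
  lower : ℚ.- 1ℚ ℚ.≤ w ℚ.+ w ℚ.- 1ℚ
  lower = ℚP.+-monoˡ-≤ (ℚ.- 1ℚ) (ℚP.+-mono-≤ 0≤w 0≤w)
  upper : w ℚ.+ w ℚ.- 1ℚ ℚ.< 1ℚ
  upper = ℚP.+-monoˡ-< (ℚ.- 1ℚ) (ℚP.+-mono-< w<1 w<1)

rd-even : ∀ y → Even (y ℚ.- rd y)
rd-even y = floor ((y ℚ.+ 1ℚ) ℚ.* half) ,
  solve 2 (λ y F → y :- (y :- con two :* F) := con two :* F) refl y (fromℤ (floor ((y ℚ.+ 1ℚ) ℚ.* half)))

rd-unique : ∀ y {z} → Centred z → Even (z ℚ.- y) → rd y ≡ z
rd-unique y {z} (-1≤z , z<1) (k , z-y≡2K) = begin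
  y ℚ.- two ℚ.* fromℤ (floor u)   ≡⟨ cong (λ m → y ℚ.- two ℚ.* fromℤ m) floor-u ⟩
  y ℚ.- two ℚ.* fromℤ (ℤ.- k)     ≡⟨ cong (λ x → y ℚ.- two ℚ.* x) (fromℤ-homo-neg k) ⟩
  y ℚ.- two ℚ.* ℚ.- K             ≡⟨ solve 2 (λ y K → y :- con two :* (:- K) := y :+ con two :* K) refl y K ⟩
  y ℚ.+ two ℚ.* K                 ≡⟨ z≡ ⟨
  z                               ∎
  where
  open ≡-Reasoning
  K = fromℤ k
  u = (y ℚ.+ 1ℚ) ℚ.* half
  w = (z ℚ.+ 1ℚ) ℚ.* half
  z≡ : z ≡ y ℚ.+ two ℚ.* K
  z≡ = trans (solve 2 (λ z y → z := y :+ (z :- y)) refl z y) (cong (y ℚ.+_) z-y≡2K)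
  u≡ : u ≡ w ℚ.- K
  u≡ = trans (solve 2 (λ y K → (y :+ con 1ℚ) :* con half := ((y :+ con two :* K) :+ con 1ℚ) :* con half :- K) refl y K)
             (cong (λ x → (x ℚ.+ 1ℚ) ℚ.* half ℚ.- K) (sym z≡))
  0≤w : 0ℚ ℚ.≤ w
  0≤w = ℚP.*-monoʳ-≤-nonNeg half (ℚP.+-monoˡ-≤ 1ℚ -1≤z)
  w<1 : w ℚ.< 1ℚ
  w<1 = ℚP.*-monoˡ-<-pos half (ℚP.+-monoˡ-< 1ℚ z<1)
  lower : fromℤ (ℤ.- k) ℚ.≤ u
  lower = subst₂ ℚ._≤_ (trans (ℚP.+-identityˡ (ℚ.- K)) (sym (fromℤ-homo-neg k))) (sym u≡) (ℚP.+-monoˡ-≤ (ℚ.- K) 0≤w)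
  upper : u ℚ.< fromℤ (ℤ.- k ℤ.+ + 1)
  upper = subst₂ ℚ._<_ (sym u≡)
            (trans (ℚP.+-comm 1ℚ (ℚ.- K)) (sym (trans (fromℤ-homo-+ (ℤ.- k) (+ 1)) (cong (ℚ._+ 1ℚ) (fromℤ-homo-neg k)))))
            (ℚP.+-monoˡ-< (ℚ.- K) w<1)
  floor-u : floor u ≡ ℤ.- k
  floor-u = floor-unique u (ℤ.- k) lower upper

rd-fixed : ∀ {z} → Centred z → rd z ≡ z
rd-fixed {z} centred = rd-unique z centred (subst Even (sym (ℚP.+-inverseʳ z)) Even-0)

rd-cong : ∀ x y → Even (x ℚ.- y) → rd x ≡ rd y
rd-cong x y even = rd-unique x (rd-centred y)
  (subst Even (solve 3 (λ x y r → :- (y :- r) :- (x :- y) := r :- x) refl x y (rd y))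
    (Even-difference (Even-neg (rd-even y)) even))

ru≡rd-neg : ∀ y → ru y ≡ rd (ℚ.- y)
ru≡rd-neg y = cong (λ x → ℚ.- y ℚ.- two ℚ.* fromℤ (floor (x ℚ.* half))) (ℚP.+-comm 1ℚ (ℚ.- y))

module ℚᴹ = Matrices ℚP.+-*-isCommutativeRing sumℚ (λ _ → refl) (λ _ → refl)

idℚ≋1ᴹ : ∀ {n} → idℚ {n} ℚᴹ.≋ ℚᴹ.1ᴹ
idℚ≋1ᴹ i j with i ≟ j
... | yes _ = refl
... | no _ = refl

≡idℚ⇒≋1ᴹ : ∀ {n} {M : Mat ℚ n} → M ≡ idℚ → M ℚᴹ.≋ ℚᴹ.1ᴹ
≡idℚ⇒≋1ᴹ refl = idℚ≋1ᴹ

toℚMat-homo-⊗ : ∀ {n} (M N : Mat ℤ n) → toℚMat (M *ᶻ N) ℚᴹ.≋ toℚMat M *ᵠ toℚMat N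
toℚMat-homo-⊗ M N i j = trans (fromℤ-homo-∑ (λ k → M i k ℤ.* N k j)) (ℚᴹ.∑-cong (λ k → fromℤ-homo-* (M i k) (N k j)))

toℚMat-1ᴹ : ∀ {n} → toℚMat (ℤᴹ.1ᴹ {n}) ℚᴹ.≋ ℚᴹ.1ᴹ
toℚMat-1ᴹ i j with i ≟ j
... | yes _ = refl
... | no _ = refl

module _ {c ℓ} (M : Monoid c ℓ) where

  open Monoid M using (_≈_; _∙_; ε; setoid; assoc; identityˡ; identityʳ; ∙-congˡ; ∙-congʳ)
    renaming (sym to ≈-sym; trans to ≈-trans)
  open import Algebra.Properties.Monoid M using (insertʳ; cancelᶜ)
  open import Relation.Binary.Reasoning.Setoid setoid

  leftInverse≈rightInverse : ∀ {l x r} → l ∙ x ≈ ε → x ∙ r ≈ ε → l ≈ r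
  leftInverse≈rightInverse {l} {x} {r} lx≈ε xr≈ε = begin
    l              ≈⟨ identityʳ l ⟨
    l ∙ ε          ≈⟨ ∙-congˡ xr≈ε ⟨
    l ∙ (x ∙ r)    ≈⟨ assoc l x r ⟨
    (l ∙ x) ∙ r    ≈⟨ ∙-congʳ lx≈ε ⟩
    ε ∙ r          ≈⟨ identityˡ r ⟩
    r              ∎

  product-rightInverse : ∀ {p u q v a b} → p ∙ u ≈ ε → q ∙ v ≈ ε → a ∙ b ≈ ε → ((p ∙ a) ∙ q) ∙ ((v ∙ b) ∙ u) ≈ ε
  product-rightInverse {p} {u} {q} {v} {a} {b} pu≈ε qv≈ε ab≈ε = begin
    ((p ∙ a) ∙ q) ∙ ((v ∙ b) ∙ u)  ≈⟨ ∙-congˡ (assoc v b u) ⟩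
    ((p ∙ a) ∙ q) ∙ (v ∙ (b ∙ u))  ≈⟨ cancelᶜ qv≈ε (p ∙ a) (b ∙ u) ⟩
    (p ∙ a) ∙ (b ∙ u)              ≈⟨ cancelᶜ ab≈ε p u ⟩
    p ∙ u                          ≈⟨ pu≈ε ⟩
    ε                              ∎

  outer-factors-invertible : ∀ {p u q v a b w} → p ∙ u ≈ ε → q ∙ v ≈ ε → a ∙ b ≈ ε → w ∙ ((p ∙ a) ∙ q) ≈ ε →
                       (v ∙ q ≈ ε) × (u ∙ p ≈ ε)
  outer-factors-invertible {p} {u} {q} {v} {a} {b} {w} pu≈ε qv≈ε ab≈ε w-inverse = vq≈ε , up≈ε
    where
    wpa∙q≈ε : ((w ∙ p) ∙ a) ∙ q ≈ ε
    wpa∙q≈ε = ≈-trans (≈-trans (assoc (w ∙ p) a q) (assoc w p (a ∙ q))) (≈-trans (∙-congˡ (≈-sym (assoc p a q))) w-inverse)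
    wpa≈v : (w ∙ p) ∙ a ≈ v
    wpa≈v = leftInverse≈rightInverse wpa∙q≈ε qv≈ε
    vq≈ε : v ∙ q ≈ ε
    vq≈ε = ≈-trans (∙-congʳ (≈-sym wpa≈v)) wpa∙q≈ε
    aqw∙p≈ε : ((a ∙ q) ∙ w) ∙ p ≈ ε
    aqw∙p≈ε = begin
      ((a ∙ q) ∙ w) ∙ p           ≈⟨ assoc (a ∙ q) w p ⟩
      (a ∙ q) ∙ (w ∙ p)           ≈⟨ ∙-congˡ (insertʳ ab≈ε (w ∙ p)) ⟩
      (a ∙ q) ∙ (((w ∙ p) ∙ a) ∙ b) ≈⟨ ∙-congˡ (∙-congʳ wpa≈v) ⟩
      (a ∙ q) ∙ (v ∙ b)           ≈⟨ cancelᶜ qv≈ε a b ⟩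
      a ∙ b                       ≈⟨ ab≈ε ⟩
      ε                           ∎
    up≈ε : u ∙ p ≈ ε
    up≈ε = ≈-trans (∙-congʳ (≈-sym (leftInverse≈rightInverse aqw∙p≈ε pu≈ε))) aqw∙p≈ε

toℚMat-rightInverse : ∀ {n} (M N : Mat ℤ n) → M *ᶻ N ℤᴹ.≋ ℤᴹ.1ᴹ → toℚMat M *ᵠ toℚMat N ℚᴹ.≋ ℚᴹ.1ᴹ
toℚMat-rightInverse M N MN≋1 i j =
  trans (sym (toℚMat-homo-⊗ M N i j)) (trans (cong fromℤ (MN≋1 i j)) (toℚMat-1ᴹ i j))

module SmithForm {n} (A : Mat ℤ n) (Ainv : Mat ℚ n) (A-Ainv : toℚMat A *ᵠ Ainv ≡ idℚ)
  (P Q S : Mat ℤ n) (P-unimodular : Unimodular P) (Q-unimodular : Unimodular Q)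
  (S≡PAQ : S ≡ (P *ᶻ A) *ᶻ Q) (S-diagonal : ∀ i j → i ≢ j → S i j ≡ + 0) where

  open ℚᴹ using (_≋_; _⊗_; ⊗-monoid; Diagonal; module DiagonalInverse)
  open Monoid (⊗-monoid n) using (setoid; assoc; ∙-congˡ; ∙-congʳ) renaming (trans to ≋-trans; sym to ≋-sym)
  open import Algebra.Properties.Monoid (⊗-monoid n) using (insertˡ)
  open import Relation.Binary.Reasoning.Setoid setoid

  U V : Mat ℤ n
  U = proj₁ (unimodular⇒rightInverse P-unimodular)
  V = proj₁ (unimodular⇒rightInverse Q-unimodular)

  W : Mat ℚ n
  W = toℚMat V ⊗ Ainv ⊗ toℚMat U

  private
    p a q s u v : Mat ℚ n
    p = toℚMat P
    a = toℚMat A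
    q = toℚMat Q
    s = toℚMat S
    u = toℚMat U
    v = toℚMat V

    pu≋1 : p ⊗ u ≋ ℚᴹ.1ᴹ
    pu≋1 = toℚMat-rightInverse P U (proj₂ (unimodular⇒rightInverse P-unimodular))

    qv≋1 : q ⊗ v ≋ ℚᴹ.1ᴹ
    qv≋1 = toℚMat-rightInverse Q V (proj₂ (unimodular⇒rightInverse Q-unimodular))

    aAinv≋1 : a ⊗ Ainv ≋ ℚᴹ.1ᴹ
    aAinv≋1 = ≡idℚ⇒≋1ᴹ A-Ainv

    s≋paq : s ≋ p ⊗ a ⊗ q
    s≋paq i j = trans (cong (λ M → fromℤ (M i j)) S≡PAQ)
      (trans (toℚMat-homo-⊗ (P *ᶻ A) Q i j) (ℚᴹ.∑-cong (λ k → cong (ℚ._* q k j) (toℚMat-homo-⊗ P A i k))))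

    s-diagonal : Diagonal s
    s-diagonal i j i≢j = cong fromℤ (S-diagonal i j i≢j)

  S⊗W≋1 : s ⊗ W ≋ ℚᴹ.1ᴹ
  S⊗W≋1 = ≋-trans (∙-congʳ {W} s≋paq) (product-rightInverse (⊗-monoid n) {p} {u} {q} {v} {a} {Ainv} pu≋1 qv≋1 aAinv≋1)

  open DiagonalInverse s-diagonal S⊗W≋1 public
    using () renaming (diagonal-inverse to S*W≡1; inverse-diagonal to W-diagonal)

  private
    vq≋1×up≋1 : (v ⊗ q ≋ ℚᴹ.1ᴹ) × (u ⊗ p ≋ ℚᴹ.1ᴹ)
    vq≋1×up≋1 = outer-factors-invertible (⊗-monoid n) {p} {u} {q} {v} {a} {Ainv} {W} pu≋1 qv≋1 aAinv≋1
                  (≋-trans (∙-congˡ {W} (≋-sym s≋paq)) W⊗S≋1)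
      where open DiagonalInverse s-diagonal S⊗W≋1 using () renaming (inverse-leftInverse to W⊗S≋1)

  V⊗Q≋1 : v ⊗ q ≋ ℚᴹ.1ᴹ
  V⊗Q≋1 = proj₁ vq≋1×up≋1

  U⊗P≋1 : u ⊗ p ≋ ℚᴹ.1ᴹ
  U⊗P≋1 = proj₂ vq≋1×up≋1

  Ainv⊗U≋Q⊗W : Ainv ⊗ u ≋ q ⊗ W
  Ainv⊗U≋Q⊗W = begin
    Ainv ⊗ u             ≈⟨ insertˡ {a = q} {c = v} qv≋1 (Ainv ⊗ u) ⟩
    q ⊗ (v ⊗ (Ainv ⊗ u)) ≈⟨ ∙-congˡ {q} (≋-sym (assoc v Ainv u)) ⟩
    q ⊗ W                ∎

  S-diagonal-positive : (∀ i → + 0 ℤ.≤ S i i) → ∀ k → Σ ℕ λ m → S k k ≡ + suc m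
  S-diagonal-positive S≥0 k = positive (S k k) refl (S≥0 k)
    where
    positive : ∀ z → S k k ≡ z → + 0 ℤ.≤ z → Σ ℕ λ m → S k k ≡ + suc m
    positive (+ zero) Skk≡0 _ =
      ⊥-elim (ℚP.1≢0 (trans (sym (S*W≡1 k)) (trans (cong (λ z → fromℤ z ℚ.* W k k) Skk≡0) (ℚP.*-zeroˡ (W k k)))))
    positive (+ suc m) Skk≡1+m _ = m , Skk≡1+m

module TilingGroup {n} (v : Vecℚ n) (A : Mat ℤ n) (Ainv : Mat ℚ n)
  (A-Ainv : toℚMat A *ᵠ Ainv ≡ idℚ) (Ainv-A : Ainv *ᵠ toℚMat A ≡ idℚ) where

  open Tiling v A Ainv
  open Setoid (Fin n →-setoid ℚ) using () renaming (sym to ≈-sym; trans to ≈-trans)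

  0ᵛ : Vecℚ n
  0ᵛ _ = 0ℚ

  infixr 7 _•_
  _•_ : ℤ → Vecℚ n → Vecℚ n
  (c • x) i = fromℤ c ℚ.* x i

  combination : ∀ {m} → (Fin m → ℤ) → (Fin m → Vecℚ n) → Vecℚ n
  combination c bs r = sumℚ (λ k → fromℤ (c k) ℚ.* bs k r)

  Ainv-A· : ∀ x → (Ainv ·ᵠ (A · x)) ≈ x
  Ainv-A· = ℚᴹ.⊛-rightInverse Ainv (toℚMat A) (≡idℚ⇒≋1ᴹ Ainv-A)

  A-Ainv· : ∀ x → (A · (Ainv ·ᵠ x)) ≈ x
  A-Ainv· = ℚᴹ.⊛-rightInverse (toℚMat A) Ainv (≡idℚ⇒≋1ᴹ A-Ainv)

  infix 4 _~_
  -- congruence modulo the lattice 2Aℤⁿ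
  _~_ : Vecℚ n → Vecℚ n → Set
  x ~ y = ∀ i → Even ((Ainv ·ᵠ x) i ℚ.- (Ainv ·ᵠ y) i)

  ~-refl : ∀ {x} → x ~ x
  ~-refl {x} i = subst Even (sym (ℚP.+-inverseʳ ((Ainv ·ᵠ x) i))) Even-0

  ≈⇒~ : ∀ {x y} → x ≈ y → x ~ y
  ≈⇒~ {x} x≈y i = subst (λ z → Even ((Ainv ·ᵠ x) i ℚ.- z)) (ℚᴹ.⊛-congʳ Ainv x≈y i) (~-refl i)

  ~-sym : ∀ {x y} → x ~ y → y ~ x
  ~-sym {x} {y} x~y i =
    subst Even (solve 2 (λ a b → :- (a :- b) := b :- a) refl ((Ainv ·ᵠ x) i) ((Ainv ·ᵠ y) i)) (Even-neg (x~y i))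

  ~-trans : ∀ {x y z} → x ~ y → y ~ z → x ~ z
  ~-trans {x} {y} {z} x~y y~z i =
    subst Even (solve 3 (λ a b c → (a :- b) :+ (b :- c) := a :- c) refl ((Ainv ·ᵠ x) i) ((Ainv ·ᵠ y) i) ((Ainv ·ᵠ z) i))
      (Even-+ (x~y i) (y~z i))

  ~-+ : ∀ {x x′ y y′} → x ~ x′ → y ~ y′ → x +ᵛ y ~ x′ +ᵛ y′
  ~-+ {x} {x′} {y} {y′} x~x′ y~y′ i = subst Even eq (Even-+ (x~x′ i) (y~y′ i))
    where
    eq : ((Ainv ·ᵠ x) i ℚ.- (Ainv ·ᵠ x′) i) ℚ.+ ((Ainv ·ᵠ y) i ℚ.- (Ainv ·ᵠ y′) i)
       ≡ (Ainv ·ᵠ (x +ᵛ y)) i ℚ.- (Ainv ·ᵠ (x′ +ᵛ y′)) i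
    eq = trans (solve 4 (λ a a′ b b′ → (a :- a′) :+ (b :- b′) := (a :+ b) :- (a′ :+ b′)) refl
                  ((Ainv ·ᵠ x) i) ((Ainv ·ᵠ x′) i) ((Ainv ·ᵠ y) i) ((Ainv ·ᵠ y′) i))
               (sym (cong₂ ℚ._-_ (ℚᴹ.⊛-distrib-+ Ainv x y i) (ℚᴹ.⊛-distrib-+ Ainv x′ y′ i)))

  ~-• : ∀ c {x y} → x ~ y → c • x ~ c • y
  ~-• c {x} {y} x~y i = subst Even eq (Even-scale c (x~y i))
    where
    eq : fromℤ c ℚ.* ((Ainv ·ᵠ x) i ℚ.- (Ainv ·ᵠ y) i) ≡ (Ainv ·ᵠ (c • x)) i ℚ.- (Ainv ·ᵠ (c • y)) i
    eq = trans (solve 3 (λ c a b → c :* (a :- b) := c :* a :- c :* b) refl (fromℤ c) ((Ainv ·ᵠ x) i) ((Ainv ·ᵠ y) i))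
               (sym (cong₂ ℚ._-_ (ℚᴹ.⊛-*ˡ Ainv (fromℤ c) x i) (ℚᴹ.⊛-*ˡ Ainv (fromℤ c) y i)))

  combination-cong : ∀ {m} (c : Fin m → ℤ) {bs bs′ : Fin m → Vecℚ n} →
                     (∀ k → bs k ~ bs′ k) → combination c bs ~ combination c bs′
  combination-cong {zero} c _ = ~-refl
  combination-cong {suc m} c bs~bs′ = ~-+ (~-• (c zero) (bs~bs′ zero)) (combination-cong (c ∘ suc) (bs~bs′ ∘ suc))

  single : Fin n → ℤ → Fin n → ℤ
  single k z l with l ≟ k
  ... | yes _ = z
  ... | no _ = + 0

  single-same : ∀ k z → single k z k ≡ z
  single-same k z with k ≟ k
  ... | yes _ = refl
  ... | no k≢k = ⊥-elim (k≢k refl)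

  single-other : ∀ k z {l} → l ≢ k → single k z l ≡ + 0
  single-other k z {l} l≢k with l ≟ k
  ... | yes l≡k = ⊥-elim (l≢k l≡k)
  ... | no _ = refl

  combination-single : ∀ k z (bs : Fin n → Vecℚ n) → combination (single k z) bs ≈ (z • bs k)
  combination-single k z bs r = trans
    (ℚᴹ.∑-single k (λ l l≢k → trans (cong (λ x → fromℤ x ℚ.* bs l r) (single-other k z l≢k)) (ℚP.*-zeroˡ (bs l r))))
    (cong (λ x → fromℤ x ℚ.* bs k r) (single-same k z))

  combination-zero : (bs : Fin n → Vecℚ n) → combination (λ _ → + 0) bs ≈ 0ᵛ
  combination-zero bs r = ℚᴹ.∑-zero (λ l → ℚP.*-zeroˡ (bs l r))

  reduce : Vecℚ n → Vecℚ n
  reduce x = A · (tv +ᵛ ⌊ (Ainv ·ᵠ x) -ᵛ tv ⌉)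

  reduce-~ : ∀ x → reduce x ~ x
  reduce-~ x i = subst Even eq (Even-neg (rd-even (X ℚ.- tv i)))
    where
    X = (Ainv ·ᵠ x) i
    eq : ℚ.- ((X ℚ.- tv i) ℚ.- rd (X ℚ.- tv i)) ≡ (Ainv ·ᵠ reduce x) i ℚ.- X
    eq = trans (solve 3 (λ X t r → :- ((X :- t) :- r) := (t :+ r) :- X) refl X (tv i) (rd (X ℚ.- tv i)))
               (cong (ℚ._- X) (sym (Ainv-A· (tv +ᵛ ⌊ (Ainv ·ᵠ x) -ᵛ tv ⌉) i)))

  ≈reduce⇒~ : ∀ {x y} → x ≈ reduce y → x ~ y
  ≈reduce⇒~ {y = y} x≈reduce-y = ~-trans (≈⇒~ x≈reduce-y) (reduce-~ y)

  reduce-cong : ∀ {x y} → x ~ y → reduce x ≈ reduce y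
  reduce-cong {x} {y} x~y = ℚᴹ.⊛-congʳ (toℚMat A) λ j →
    cong (tv j ℚ.+_) (rd-cong ((Ainv ·ᵠ x) j ℚ.- tv j) ((Ainv ·ᵠ y) j ℚ.- tv j)
      (subst Even (solve 3 (λ a b t → a :- b := (a :- t) :- (b :- t)) refl ((Ainv ·ᵠ x) j) ((Ainv ·ᵠ y) j) (tv j)) (x~y j)))

  reduce-fixed : ∀ {y} → InG y → reduce y ≈ y
  reduce-fixed {y} y∈G = ≈-trans (ℚᴹ.⊛-congʳ (toℚMat A) centre) (A-Ainv· y)
    where
    centre : ∀ j → tv j ℚ.+ rd (t y j) ≡ (Ainv ·ᵠ y) j
    centre j = trans (cong (tv j ℚ.+_) (rd-fixed (y∈G j)))
                     (solve 2 (λ t a → t :+ (a :- t) := a) refl (tv j) ((Ainv ·ᵠ y) j))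

  ~-integral : ∀ {x y} → x ~ y → IsIntegral y → IsIntegral x
  ~-integral {x} {y} x~y y-integral i = subst Integral x≡y+Ad (Integral-+ (y-integral i) Ad-integral)
    where
    d : Vecℚ n
    d j = (Ainv ·ᵠ x) j ℚ.- (Ainv ·ᵠ y) j
    Ad-integral : Integral ((A · d) i)
    Ad-integral = Integral-∑ _ (λ j → Even⇒Integral (Even-scale (A i j) (x~y j)))
    x≡y+Ad : y i ℚ.+ (A · d) i ≡ x i
    x≡y+Ad = begin
      y i ℚ.+ (A · d) i                     ≡⟨ cong (ℚ._+ (A · d) i) (A-Ainv· y i) ⟨
      (A · (Ainv ·ᵠ y)) i ℚ.+ (A · d) i     ≡⟨ ℚᴹ.⊛-distrib-+ (toℚMat A) (Ainv ·ᵠ y) d i ⟨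
      (A · ((Ainv ·ᵠ y) +ᵛ d)) i            ≡⟨ ℚᴹ.⊛-congʳ (toℚMat A) (λ j → cancel ((Ainv ·ᵠ y) j) ((Ainv ·ᵠ x) j)) i ⟩
      (A · (Ainv ·ᵠ x)) i                   ≡⟨ A-Ainv· x i ⟩
      x i                                   ∎
      where
      open ≡-Reasoning
      cancel : ∀ b a → b ℚ.+ (a ℚ.- b) ≡ a
      cancel = solve 2 (λ b a → b :+ (a :- b) := a) refl

  ⊕≈reduce : ∀ y z → (y ⊕ z) ≈ reduce (y +ᵛ z)
  ⊕≈reduce y z = ℚᴹ.⊛-congʳ (toℚMat A) λ j → cong (λ w → tv j ℚ.+ rd w) (begin
    (tv j ℚ.+ t y j) ℚ.+ t z j                         ≡⟨ solve 3 (λ t a b → (t :+ (a :- t)) :+ (b :- t) := (a :+ b) :- t) refl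
                                                           (tv j) ((Ainv ·ᵠ y) j) ((Ainv ·ᵠ z) j) ⟩
    ((Ainv ·ᵠ y) j ℚ.+ (Ainv ·ᵠ z) j) ℚ.- tv j          ≡⟨ cong (ℚ._- tv j) (ℚᴹ.⊛-distrib-+ Ainv y z j) ⟨
    (Ainv ·ᵠ (y +ᵛ z)) j ℚ.- tv j                       ∎)
    where open ≡-Reasoning

  e≈reduce-0ᵛ : e ≈ reduce 0ᵛ
  e≈reduce-0ᵛ = ℚᴹ.⊛-congʳ (toℚMat A) λ j → cong (tv j ℚ.+_) (trans (ru≡rd-neg (tv j)) (cong rd (sym (-tv≡ j))))
    where
    -tv≡ : ∀ j → (Ainv ·ᵠ 0ᵛ) j ℚ.- tv j ≡ ℚ.- tv j
    -tv≡ j = trans (cong (ℚ._- tv j) (ℚᴹ.∑-zero (λ k → ℚP.*-zeroʳ (Ainv j k)))) (ℚP.+-identityˡ (ℚ.- tv j))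

  ×ᵍ≈reduce : ∀ m b → (m ×ᵍ b) ≈ reduce (+ m • b)
  ×ᵍ≈reduce zero b = ≈-trans e≈reduce-0ᵛ (reduce-cong (≈⇒~ (λ i → sym (ℚP.*-zeroˡ (b i)))))
  ×ᵍ≈reduce (suc m) b =
    ≈-trans (⊕≈reduce b (m ×ᵍ b)) (reduce-cong (~-trans (~-+ (~-refl {b}) (≈reduce⇒~ (×ᵍ≈reduce m b))) (≈⇒~ b+mb≈[1+m]b)))
    where
    b+mb≈[1+m]b : (b +ᵛ (+ m • b)) ≈ (+ suc m • b)
    b+mb≈[1+m]b i = trans (solve 2 (λ x k → x :+ k :* x := (con 1ℚ :+ k) :* x) refl (b i) (fromℤ (+ m)))
                          (cong (ℚ._* b i) (sym (fromℤ-homo-+ (+ 1) (+ m))))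

  combo≈reduce : ∀ {m} (i : Fin m → ℕ) bs → combo i bs ≈ reduce (combination (+_ ∘ i) bs)
  combo≈reduce {zero} i bs = e≈reduce-0ᵛ
  combo≈reduce {suc m} i bs = ≈-trans (⊕≈reduce _ _)
    (reduce-cong (~-+ (≈reduce⇒~ (×ᵍ≈reduce (i zero) (bs zero))) (≈reduce⇒~ (combo≈reduce (i ∘ suc) (bs ∘ suc)))))

  reduce-injective : ∀ {x y} → reduce x ≈ reduce y → x ~ y
  reduce-injective {x} {y} reduce-x≈reduce-y = ~-trans (~-sym (reduce-~ x)) (≈reduce⇒~ reduce-x≈reduce-y)

  columns : (Fin n → Vecℚ n) → Mat ℚ n
  columns bs r k = bs k r

  combination≈columns : ∀ (c : Fin n → ℤ) bs → combination c bs ≈ (columns bs ·ᵠ (fromℤ ∘ c))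
  combination≈columns c bs r = ℚᴹ.∑-cong (λ k → ℚP.*-comm (fromℤ (c k)) (bs k r))

module Basis {n} (v : Vecℚ n) (A : Mat ℤ n) (Ainv : Mat ℚ n)
  (A-Ainv : toℚMat A *ᵠ Ainv ≡ idℚ) (Ainv-A : Ainv *ᵠ toℚMat A ≡ idℚ)
  (P Q S : Mat ℤ n) (P-unimodular : Unimodular P) (Q-unimodular : Unimodular Q)
  (S≡PAQ : S ≡ (P *ᶻ A) *ᶻ Q) (S-diagonal : ∀ i j → i ≢ j → S i j ≡ + 0) (S≥0 : ∀ i → + 0 ℤ.≤ S i i) where

  open Tiling v A Ainv
  open TilingGroup v A Ainv A-Ainv Ainv-A
  open SmithForm A Ainv A-Ainv P Q S P-unimodular Q-unimodular S≡PAQ S-diagonal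
  open Setoid (Fin n →-setoid ℚ) using () renaming (sym to ≈-sym; trans to ≈-trans)

  b : Fin n → Vecℚ n
  b k = A · (tv +ᵛ ⌈ tv -ᵛ ⌊ (λ i → divℤ (Q i k) (S k k)) ⌉ ⌋)

  u : Fin n → Vecℚ n
  u k r = fromℤ (U r k)

  order : Fin n → ℕ
  order k = 2 ℕ.* suc (proj₁ (S-diagonal-positive S≥0 k))

  order≡2S : ∀ k → + order k ≡ + 2 ℤ.* S k k
  order≡2S k = trans (ℤP.pos-* 2 (suc (proj₁ (S-diagonal-positive S≥0 k))))
                     (cong (+ 2 ℤ.*_) (sym (proj₂ (S-diagonal-positive S≥0 k))))

  divℤ≡Q*W : ∀ i k → divℤ (Q i k) (S k k) ≡ fromℤ (Q i k) ℚ.* W k k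
  divℤ≡Q*W i k = begin
    divℤ (Q i k) (S k k)                        ≡⟨ cong (divℤ (Q i k)) Skk≡1+m ⟩
    x                                           ≡⟨ ℚP.*-identityˡ x ⟨
    1ℚ ℚ.* x                                    ≡⟨ cong (ℚ._* x) (trans (sym (S*W≡1 k)) (ℚP.*-comm (fromℤ (S k k)) (W k k))) ⟩
    (W k k ℚ.* fromℤ (S k k)) ℚ.* x             ≡⟨ ℚP.*-assoc (W k k) (fromℤ (S k k)) x ⟩
    W k k ℚ.* (fromℤ (S k k) ℚ.* x)             ≡⟨ cong (λ z → W k k ℚ.* (fromℤ z ℚ.* x)) Skk≡1+m ⟩
    W k k ℚ.* (fromℤ (+ suc m) ℚ.* x)           ≡⟨ cong (W k k ℚ.*_) (fromℤ-*-/ (Q i k) m) ⟩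
    W k k ℚ.* fromℤ (Q i k)                     ≡⟨ ℚP.*-comm (W k k) (fromℤ (Q i k)) ⟩
    fromℤ (Q i k) ℚ.* W k k                     ∎
    where
    open ≡-Reasoning
    m = proj₁ (S-diagonal-positive S≥0 k)
    Skk≡1+m = proj₂ (S-diagonal-positive S≥0 k)
    x = Q i k ℚ./ suc m

  Ainv·u : ∀ k r → (Ainv ·ᵠ u k) r ≡ fromℤ (Q r k) ℚ.* W k k
  Ainv·u k r = trans (Ainv⊗U≋Q⊗W r k)
    (ℚᴹ.∑-single k (λ l l≢k → trans (cong (fromℤ (Q r l) ℚ.*_) (W-diagonal l k l≢k)) (ℚP.*-zeroʳ (fromℤ (Q r l)))))

  b~u : ∀ k → b k ~ u k
  b~u k i = subst Even eq (Even-+ (Even-neg (rd-even (ℚ.- y))) (Even-neg (rd-even w)))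
    where
    open ≡-Reasoning
    w = divℤ (Q i k) (S k k)
    y = tv i ℚ.- rd w
    eq : ℚ.- (ℚ.- y ℚ.- rd (ℚ.- y)) ℚ.+ ℚ.- (w ℚ.- rd w) ≡ (Ainv ·ᵠ b k) i ℚ.- (Ainv ·ᵠ u k) i
    eq = begin
      ℚ.- (ℚ.- y ℚ.- rd (ℚ.- y)) ℚ.+ ℚ.- (w ℚ.- rd w)
        ≡⟨ solve 4 (λ t w r r′ → :- (:- (t :- r) :- r′) :+ :- (w :- r) := (t :+ r′) :- w) refl (tv i) w (rd w) (rd (ℚ.- y)) ⟩
      (tv i ℚ.+ rd (ℚ.- y)) ℚ.- w
        ≡⟨ cong (λ z → (tv i ℚ.+ z) ℚ.- w) (ru≡rd-neg y) ⟨
      (tv i ℚ.+ ru y) ℚ.- w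
        ≡⟨ cong₂ ℚ._-_ (Ainv-A· (tv +ᵛ ⌈ tv -ᵛ ⌊ (λ j → divℤ (Q j k) (S k k)) ⌉ ⌋) i)
                       (trans (Ainv·u k i) (sym (divℤ≡Q*W i k))) ⟨
      (Ainv ·ᵠ b k) i ℚ.- (Ainv ·ᵠ u k) i ∎

  b∈G : ∀ k → InG (b k)
  b∈G k i = subst Centred (sym t-b) (rd-centred (ℚ.- y))
    where
    y = tv i ℚ.- rd (divℤ (Q i k) (S k k))
    t-b : t (b k) i ≡ rd (ℚ.- y)
    t-b = trans (cong (ℚ._- tv i) (Ainv-A· (tv +ᵛ ⌈ tv -ᵛ ⌊ (λ j → divℤ (Q j k) (S k k)) ⌉ ⌋) i))
                (trans (solve 2 (λ t r → (t :+ r) :- t := r) refl (tv i) (ru y)) (ru≡rd-neg y))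

  b∈GI : ∀ k → InGI (b k)
  b∈GI k = ~-integral (b~u k) (λ r → U r k , refl) , b∈G k

  Ainv-combination-u : ∀ c → (Ainv ·ᵠ combination c u) ≈ (toℚMat Q ·ᵠ (W ·ᵠ (fromℤ ∘ c)))
  Ainv-combination-u c r = begin
    (Ainv ·ᵠ combination c u) r                   ≡⟨ ℚᴹ.⊛-congʳ Ainv (combination≈columns c u) r ⟩
    (Ainv ·ᵠ (toℚMat U ·ᵠ (fromℤ ∘ c))) r         ≡⟨ ℚᴹ.⊛-assoc Ainv (toℚMat U) (fromℤ ∘ c) r ⟨
    ((Ainv *ᵠ toℚMat U) ·ᵠ (fromℤ ∘ c)) r         ≡⟨ ℚᴹ.⊛-congˡ Ainv⊗U≋Q⊗W (fromℤ ∘ c) r ⟩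
    ((toℚMat Q *ᵠ W) ·ᵠ (fromℤ ∘ c)) r            ≡⟨ ℚᴹ.⊛-assoc (toℚMat Q) W (fromℤ ∘ c) r ⟩
    (toℚMat Q ·ᵠ (W ·ᵠ (fromℤ ∘ c))) r            ∎
    where open ≡-Reasoning

  δ : (Fin n → ℤ) → (Fin n → ℤ) → Vecℚ n
  δ c c′ k = W k k ℚ.* fromℤ (c k ℤ.- c′ k)

  Ainv-combination-u-difference : ∀ c c′ r →
    (Ainv ·ᵠ combination c u) r ℚ.- (Ainv ·ᵠ combination c′ u) r ≡ (toℚMat Q ·ᵠ δ c c′) r
  Ainv-combination-u-difference c c′ r = begin
    (Ainv ·ᵠ combination c u) r ℚ.- (Ainv ·ᵠ combination c′ u) r
      ≡⟨ cong₂ ℚ._-_ (Ainv-combination-u c r) (Ainv-combination-u c′ r) ⟩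
    (toℚMat Q ·ᵠ (W ·ᵠ (fromℤ ∘ c))) r ℚ.- (toℚMat Q ·ᵠ (W ·ᵠ (fromℤ ∘ c′))) r
      ≡⟨ ℚᴹ.⊛-distrib-difference (toℚMat Q) (W ·ᵠ (fromℤ ∘ c)) (W ·ᵠ (fromℤ ∘ c′)) r ⟨
    (toℚMat Q ·ᵠ (λ k → (W ·ᵠ (fromℤ ∘ c)) k ℚ.- (W ·ᵠ (fromℤ ∘ c′)) k)) r
      ≡⟨ ℚᴹ.⊛-congʳ (toℚMat Q) δ≡ r ⟩
    (toℚMat Q ·ᵠ δ c c′) r ∎
    where
    open ≡-Reasoning
    δ≡ : ∀ k → (W ·ᵠ (fromℤ ∘ c)) k ℚ.- (W ·ᵠ (fromℤ ∘ c′)) k ≡ δ c c′ k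
    δ≡ k = begin
      (W ·ᵠ (fromℤ ∘ c)) k ℚ.- (W ·ᵠ (fromℤ ∘ c′)) k
        ≡⟨ cong₂ ℚ._-_ (ℚᴹ.⊛-diagonal W-diagonal (fromℤ ∘ c) k) (ℚᴹ.⊛-diagonal W-diagonal (fromℤ ∘ c′) k) ⟩
      W k k ℚ.* fromℤ (c k) ℚ.- W k k ℚ.* fromℤ (c′ k)
        ≡⟨ solve 3 (λ w x y → w :* x :- w :* y := w :* (x :+ (:- y))) refl (W k k) (fromℤ (c k)) (fromℤ (c′ k)) ⟩
      W k k ℚ.* (fromℤ (c k) ℚ.+ ℚ.- fromℤ (c′ k))
        ≡⟨ cong (λ z → W k k ℚ.* (fromℤ (c k) ℚ.+ z)) (fromℤ-homo-neg (c′ k)) ⟨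
      W k k ℚ.* (fromℤ (c k) ℚ.+ fromℤ (ℤ.- c′ k))
        ≡⟨ cong (W k k ℚ.*_) (fromℤ-homo-+ (c k) (ℤ.- c′ k)) ⟨
      δ c c′ k ∎

  ∣⇒Even : ∀ k {d} → + order k ∣ d → Even (W k k ℚ.* fromℤ d)
  ∣⇒Even k {d} (divides t d≡t*o) = t , (begin
    W k k ℚ.* fromℤ d
      ≡⟨ cong (λ z → W k k ℚ.* fromℤ z) (trans d≡t*o (cong (t ℤ.*_) (order≡2S k))) ⟩
    W k k ℚ.* fromℤ (t ℤ.* (+ 2 ℤ.* S k k))
      ≡⟨ cong (W k k ℚ.*_) (trans (fromℤ-homo-* t _) (cong (fromℤ t ℚ.*_) (fromℤ-homo-* (+ 2) (S k k)))) ⟩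
    W k k ℚ.* (fromℤ t ℚ.* (two ℚ.* fromℤ (S k k)))
      ≡⟨ solve 4 (λ w t c s → w :* (t :* (c :* s)) := c :* t :* (s :* w)) refl (W k k) (fromℤ t) two (fromℤ (S k k)) ⟩
    two ℚ.* fromℤ t ℚ.* (fromℤ (S k k) ℚ.* W k k)
      ≡⟨ cong (two ℚ.* fromℤ t ℚ.*_) (S*W≡1 k) ⟩
    two ℚ.* fromℤ t ℚ.* 1ℚ
      ≡⟨ ℚP.*-identityʳ (two ℚ.* fromℤ t) ⟩
    two ℚ.* fromℤ t ∎)
    where open ≡-Reasoning

  Even⇒∣ : ∀ k {d} → Even (W k k ℚ.* fromℤ d) → + order k ∣ d
  Even⇒∣ k {d} (t , Wd≡2t) = divides t (fromℤ-injective (begin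
    fromℤ d                                       ≡⟨ ℚP.*-identityˡ (fromℤ d) ⟨
    1ℚ ℚ.* fromℤ d                                ≡⟨ cong (ℚ._* fromℤ d) (S*W≡1 k) ⟨
    fromℤ (S k k) ℚ.* W k k ℚ.* fromℤ d           ≡⟨ ℚP.*-assoc (fromℤ (S k k)) (W k k) (fromℤ d) ⟩
    fromℤ (S k k) ℚ.* (W k k ℚ.* fromℤ d)         ≡⟨ cong (fromℤ (S k k) ℚ.*_) Wd≡2t ⟩
    fromℤ (S k k) ℚ.* (two ℚ.* fromℤ t)           ≡⟨ rearrange (fromℤ (S k k)) (fromℤ t) ⟩
    fromℤ t ℚ.* (two ℚ.* fromℤ (S k k))           ≡⟨ cong (fromℤ t ℚ.*_) (fromℤ-homo-* (+ 2) (S k k)) ⟨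
    fromℤ t ℚ.* fromℤ (+ 2 ℤ.* S k k)             ≡⟨ fromℤ-homo-* t (+ 2 ℤ.* S k k) ⟨
    fromℤ (t ℤ.* (+ 2 ℤ.* S k k))                 ≡⟨ cong (λ z → fromℤ (t ℤ.* z)) (order≡2S k) ⟨
    fromℤ (t ℤ.* + order k)                       ∎))
    where
    open ≡-Reasoning
    rearrange : ∀ s t → s ℚ.* (two ℚ.* t) ≡ t ℚ.* (two ℚ.* s)
    rearrange = solve 2 (λ s t → s :* (con two :* t) := t :* (con two :* s)) refl

  ∣⇒combination-u-~ : ∀ c c′ → (∀ k → + order k ∣ c k ℤ.- c′ k) → combination c u ~ combination c′ u
  ∣⇒combination-u-~ c c′ order∣ r =
    subst Even (sym (Ainv-combination-u-difference c c′ r)) (Even-⊛ Q (λ k → ∣⇒Even k (order∣ k)) r)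

  combination-u-~⇒∣ : ∀ c c′ → combination c u ~ combination c′ u → ∀ k → + order k ∣ c k ℤ.- c′ k
  combination-u-~⇒∣ c c′ c~c′ k = Even⇒∣ k (subst Even (ℚᴹ.⊛-rightInverse (toℚMat V) (toℚMat Q) V⊗Q≋1 (δ c c′) k)
    (Even-⊛ V (λ r → subst Even (Ainv-combination-u-difference c c′ r) (c~c′ r)) k))

  ×ᵍ≈reduce-single : ∀ m k → (m ×ᵍ b k) ≈ reduce (combination (single k (+ m)) u)
  ×ᵍ≈reduce-single m k = ≈-trans (×ᵍ≈reduce m (b k))
    (reduce-cong (~-trans (~-• (+ m) (b~u k)) (≈⇒~ (≈-sym (combination-single k (+ m) u)))))

  e≈reduce-combination-0 : e ≈ reduce (combination (λ _ → + 0) u)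
  e≈reduce-combination-0 = ≈-trans e≈reduce-0ᵛ (reduce-cong (≈⇒~ (≈-sym (combination-zero u))))

  ×ᵍ≈e⇒∣ : ∀ m k → (m ×ᵍ b k) ≈ e → + order k ∣ + m
  ×ᵍ≈e⇒∣ m k mb≈e = subst (+ order k ∣_) (trans (ℤP.+-identityʳ _) (single-same k (+ m)))
    (combination-u-~⇒∣ (single k (+ m)) (λ _ → + 0)
      (reduce-injective (≈-trans (≈-sym (×ᵍ≈reduce-single m k)) (≈-trans mb≈e e≈reduce-combination-0))) k)

  ∣⇒×ᵍ≈e : ∀ m k → + order k ∣ + m → (m ×ᵍ b k) ≈ e
  ∣⇒×ᵍ≈e m k order∣m = ≈-trans (×ᵍ≈reduce-single m k)
    (≈-trans (reduce-cong (∣⇒combination-u-~ (single k (+ m)) (λ _ → + 0) divisible)) (≈-sym e≈reduce-combination-0))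
    where
    divisible : ∀ l → + order l ∣ single k (+ m) l ℤ.- + 0
    divisible l with l ≟ k
    ... | yes refl = subst (+ order l ∣_) (sym (ℤP.+-identityʳ (+ m))) order∣m
    ... | no _ = divides (+ 0) refl

  b-order : ∀ k → IsOrder (b k) (order k)
  b-order k = ℕ.s≤s ℕ.z≤n , ∣⇒×ᵍ≈e (order k) k (divides (+ 1) (sym (ℤP.*-identityˡ (+ order k)))) , not-earlier
    where
    not-earlier : ∀ j → 0 ℕ.< j → j ℕ.< order k → ¬ ((j ×ᵍ b k) ≈ e)
    not-earlier j 0<j j<order jb≈e = ℕP.<⇒≢ 0<j (sym (∣-bounded⇒≡ j<order (ℕ.s≤s ℕ.z≤n)
      (subst (+ order k ∣_) (sym (ℤP.+-identityʳ (+ j))) (×ᵍ≈e⇒∣ j k jb≈e))))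

  combo≈reduce-u : ∀ (i : Fin n → ℕ) → combo i b ≈ reduce (combination (+_ ∘ i) u)
  combo≈reduce-u i = ≈-trans (combo≈reduce i b) (reduce-cong (combination-cong (+_ ∘ i) b~u))

  independent : ∀ i j → (∀ k → i k ℕ.< order k) → (∀ k → j k ℕ.< order k) → combo i b ≈ combo j b → ∀ k → i k ≡ j k
  independent i j i<order j<order i≈j k = ∣-bounded⇒≡ (i<order k) (j<order k)
    (combination-u-~⇒∣ (+_ ∘ i) (+_ ∘ j) (reduce-injective (≈-trans (≈-sym (combo≈reduce-u i)) (≈-trans i≈j (combo≈reduce-u j)))) k)

  spanning : ∀ y → InGI y → Σ (Fin n → ℕ) λ i → (∀ k → i k ℕ.< order k) × (combo i b ≈ y)
  spanning y (y-integral , y∈G) = i , (λ k → ℤD.n%d<d (c k) (+ order k)) , combo-i≈y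
    where
    c : Fin n → ℤ
    c k = sumℤ (λ l → P k l ℤ.* proj₁ (y-integral l))
    i : Fin n → ℕ
    i k = c k ℤD.% + order k
    Py≈c : (toℚMat P ·ᵠ y) ≈ (fromℤ ∘ c)
    Py≈c k = trans (ℚᴹ.∑-cong (λ l → trans (cong (fromℤ (P k l) ℚ.*_) (proj₂ (y-integral l))) (sym (fromℤ-homo-* (P k l) _))))
                   (sym (fromℤ-homo-∑ (λ l → P k l ℤ.* proj₁ (y-integral l))))
    y≈combination : y ≈ combination c u
    y≈combination = ≈-trans (≈-sym (ℚᴹ.⊛-rightInverse (toℚMat U) (toℚMat P) U⊗P≋1 y))
                            (≈-trans (ℚᴹ.⊛-congʳ (toℚMat U) Py≈c) (≈-sym (combination≈columns c u)))
    order∣i-c : ∀ k → + order k ∣ + i k ℤ.- c k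
    order∣i-c k = divides (ℤ.- (c k ℤD./ + order k)) (trans (cong (λ x → + i k ℤ.- x) (ℤD.a≡a%n+[a/n]*n (c k) (+ order k)))
                                                         (cancel (+ i k) (c k ℤD./ + order k) (+ order k)))
      where
      cancel : ∀ a q o → a ℤ.- (a ℤ.+ q ℤ.* o) ≡ (ℤ.- q) ℤ.* o
      cancel = solve-∀
    combo-i≈y : combo i b ≈ y
    combo-i≈y = ≈-trans (combo≈reduce-u i)
      (≈-trans (reduce-cong (~-trans (∣⇒combination-u-~ (+_ ∘ i) c order∣i-c) (≈⇒~ (≈-sym y≈combination))))
               (reduce-fixed y∈G))

  isBasis : IsBasis b
  isBasis = b∈GI , order , b-order , spanning , independent

mainTheorem10 : (n : ℕ) (v : Vecℚ n) (A : Mat ℤ n) →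
    ∣ det A ∣ ≢ 0 →
    (Ainv : Mat ℚ n) → (toℚMat A *ᵠ Ainv) ≡ idℚ → (Ainv *ᵠ toℚMat A) ≡ idℚ →
    (P Q S : Mat ℤ n) → Unimodular P → Unimodular Q →
    S ≡ ((P *ᶻ A) *ᶻ Q) → IsSmithNormalForm S →
    Tiling.IsBasis v A Ainv
      (λ k → A · (Tiling.tv v A Ainv
                   +ᵛ ⌈ Tiling.tv v A Ainv -ᵛ ⌊ (λ i → divℤ (Q i k) (S k k)) ⌉ ⌋))
mainTheorem10 n v A _ Ainv A-Ainv Ainv-A P Q S P-unimodular Q-unimodular S≡PAQ (S-diagonal , S≥0 , _) =
  Basis.isBasis v A Ainv A-Ainv Ainv-A P Q S P-unimodular Q-unimodular S≡PAQ S-diagonal S≥0
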